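{- For integers $a,b\geq 0$, the number of $\mathbf u\in\mathsf{Shuf}(m,n)$ with $\mathsf{in}_{\mathrm{trans}}(\mathbf u)=a$ and $\mathsf{in}_{\mathrm{indel}}(\mathbf u)=b$ is $\binom{m}{a}\binom{n}{a}\binom{m+n-2a}{b}$.
   Context: Fix $m,n\geq0$, $X=\{x_1,\dots,x_m\}$, $Y=\{y_1,\dots,y_n\}$. A shuffle word is a word over $X\cup Y$ without repeated letters in which $x_i$ precedes $x_j$ and $y_i$ precedes $y_j$ whenever both occur and $i<j$; $\mathsf{Shuf}(m,n)$ is the set of them. The bubble lattice $\mathbf{Bub}(m,n)$ orders $\mathsf{Shuf}(m,n)$ by the reflexive–transitive closure of the elementary moves $\mathbf u\to\mathbf v$: (indel) delete a letter of $X$ or insert a letter of $Y$; (transposition) replace a consecutive factor $xy$ ($x\in X,y\in Y$) by $yx$. For $\mathbf u\in\mathsf{Shuf}(m,n)$, $\mathsf{in}_{\mathrm{trans}}(\mathbf u)$ is the number of lower covers $\mathbf u'$ of $\mathbf u$ in $\mathbf{Bub}(m,n)$ such that $\mathbf u$ is obtained from $\mathbf u'$ by a transposition, and $\mathsf{in}_{\mathrm{indel}}(\mathbf u)$ is the number of lower covers $\mathbf u'$ of $\mathbf u$ such that $\mathbf u$ is obtained from $\mathbf u'$ by an indel. -}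

module Defs where

open import Data.Nat using (ℕ)
open import Data.Fin using (Fin) renaming (_<_ to _<ᶠ_)
open import Data.List using (List; []; _∷_; _++_)
open import Data.List.Relation.Unary.Unique.Propositional using (Unique)
open import Data.List.Relation.Unary.AllPairs using (AllPairs)
open import Data.Product using (Σ; _×_; ∃)
open import Data.Sum using (_⊎_)
open import Data.Unit using (⊤)
open import Data.Irrelevant using (Irrelevant)
open import Function.Bundles using (_↔_)
open import Relation.Binary.PropositionalEquality using (_≡_; _≢_)
open import Relation.Binary.Construct.Closure.ReflexiveTransitive using (Star)

-- Alphabet X ∪ Y : x i = x_{i+1} (i : Fin m), y j = y_{j+1} (j : Fin n)
data Letter (m n : ℕ) : Set where
  x : Fin m → Letter m n
  y : Fin n → Letter m n

Word : ℕ → ℕ → Set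
Word m n = List (Letter m n)

Before : ∀ {m n} → Letter m n → Letter m n → Set
Before (x i) (x k) = i <ᶠ k
Before (y j) (y l) = j <ᶠ l
Before (x _) (y _) = ⊤
Before (y _) (x _) = ⊤

IsShuf : ∀ {m n} → Word m n → Set
IsShuf w = Unique w × AllPairs Before w

data IndelStep {m n : ℕ} : Word m n → Word m n → Set where
  del : ∀ p s (i : Fin m) → IndelStep (p ++ x i ∷ s) (p ++ s)
  ins : ∀ p s (j : Fin n) → IndelStep (p ++ s) (p ++ y j ∷ s)

data TransStep {m n : ℕ} : Word m n → Word m n → Set where
  swap : ∀ p s (i : Fin m) (j : Fin n) → TransStep (p ++ x i ∷ y j ∷ s) (p ++ y j ∷ x i ∷ s)

Step : ∀ {m n} → Word m n → Word m n → Set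
Step u v = IndelStep u v ⊎ TransStep u v

Move : ∀ {m n} → Word m n → Word m n → Set
Move u v = IsShuf u × IsShuf v × Step u v

_≤B_ : ∀ {m n} → Word m n → Word m n → Set
u ≤B v = Star Move u v

LowerCover : ∀ {m n} → Word m n → Word m n → Set
LowerCover {m} {n} u' u =
  IsShuf u' × IsShuf u × u' ≤B u × u' ≢ u ×
  (∀ (w : Word m n) → IsShuf w → u' ≤B w → w ≤B u → w ≡ u' ⊎ w ≡ u)

HasCard : Set → ℕ → Set
HasCard A k = A ↔ Fin k

-- lower covers u' of u such that u is obtained from u' by a transposition / an indel
-- (the proof data is made irrelevant so that the type counts words u')
TransLowerCovers : ∀ {m n} → Word m n → Set
TransLowerCovers {m} {n} u = Σ (Word m n) λ u' → Irrelevant (LowerCover u' u × TransStep u' u)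

IndelLowerCovers : ∀ {m n} → Word m n → Set
IndelLowerCovers {m} {n} u = Σ (Word m n) λ u' → Irrelevant (LowerCover u' u × IndelStep u' u)

InTrans≡ : ∀ {m n} → Word m n → ℕ → Set
InTrans≡ u a = HasCard (TransLowerCovers u) a

InIndel≡ : ∀ {m n} → Word m n → ℕ → Set
InIndel≡ u b = HasCard (IndelLowerCovers u) b

-- A lower cover of a shuffle word u by a transposition undoes a factor y x of u.
-- A lower cover by an indel either deletes a y of u that is followed by another y or ends u,
-- or inserts an x that is absent from u at the unique place where it is followed by an x or ends
-- the word; at any other place an intermediate word (obtained by a transposition) would exist.
-- Call an x matched if it directly follows a y, and a y matched if an x directly follows it.
-- Then in_trans(u) is the number of matched x's, which is also the number of matched y's,
-- and in_indel(u) is the number of absent x's plus the number of unmatched y's. A shuffle word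
-- is determined by the tags matched / unmatched / absent of its letters, and every tagging with
-- equally many matched x's and y's arises. So the words counted are chosen by picking the a
-- matched x's, the a matched y's, and b of the remaining m + n - 2a letters.

module Submission where

open import Defs
open import Data.Bool using (Bool; true; false)
open import Data.Empty using (⊥-elim; ⊥-elim-irr)
open import Data.Fin using (Fin; zero; suc) renaming (_<_ to _<ᶠ_)
open import Data.Fin.Permutation using (↔⇒≡)
open import Data.Fin.Properties using (+↔⊎; *↔×; _<?_; <-irrefl; <-asym; <-trans; <-cmp) renaming (_≟_ to _≟ᶠ_)
open import Data.Irrelevant using (Irrelevant; [_])
open import Data.List using (List; []; _∷_; _++_; length; lookup; map; filter; allFin)
open import Data.List.Membership.DecPropositional using () renaming (_∈?_ to ∈-dec)
open import Data.List.Membership.Propositional using (_∈_; _∉_)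
open import Data.List.Membership.Propositional.Properties
  using (∈-insert; ∈-lookup; ∈-map⁺; ∈-map⁻; map∷⁻; ∈-filter⁺; ∈-filter⁻; ∈-allFin; ∈-++⁻; ∈-++⁺ˡ; ∈-++⁺ʳ)
open import Data.List.Membership.Propositional.Properties.WithK using (unique⇒irrelevant)
open import Data.List.Properties
  using (++-assoc; ++-cancelˡ; ++-identityʳ; ∷-injectiveʳ; ∷-injectiveˡ; ≡-dec; length-++; length-++-sucʳ; length-map;
         length-tabulate; filter-++; filter-accept; filter-reject; filter-all; filter-≐)
import Data.List.Relation.Binary.Sublist.Propositional as Sublist
open import Data.List.Relation.Binary.Sublist.Propositional using (_⊆_; []; _∷_; _∷ʳ_)
open import Data.List.Relation.Binary.Sublist.Propositional.Properties using (∷⁻; ∷ʳ⁻)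
open import Data.List.Relation.Unary.All as All using (All; []; _∷_)
open import Data.List.Relation.Unary.All.Properties using (¬Any⇒All¬)
open import Data.List.Relation.Unary.AllPairs as AllPairs using (AllPairs; []; _∷_; allPairs?)
import Data.List.Relation.Unary.AllPairs.Properties as AllPairsₚ
open import Data.List.Relation.Unary.Any using (here; there; index)
open import Data.List.Relation.Unary.Any.Properties using (lookup-index)
open import Data.List.Relation.Unary.Unique.Propositional using (Unique)
import Data.List.Relation.Unary.Unique.Propositional.Properties as Uniqueₚ
open import Data.Nat using (ℕ; zero; suc; _+_; _*_; _∸_; _≤_; s≤s; _≟_)
open import Data.Nat.Combinatorics using (_C_; nCk+nC[k+1]≡[n+1]C[k+1])
open import Data.Nat.Properties
  using (suc-injective; 0≢1+n; 1+n≢0; +-comm; +-suc; +-identityʳ; +-cancelˡ-≡; +-commutativeSemigroup;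
         m+n∸n≡m; m≢1+n+m; m≤m+n; ≤-reflexive)
open import Algebra.Properties.CommutativeSemigroup +-commutativeSemigroup using (interchange)
open import Data.Product using (Σ; _×_; _,_; proj₁; proj₂; uncurry)
open import Data.Product.Function.NonDependent.Propositional using (_×-↔_)
open import Data.Sum using (_⊎_; inj₁; inj₂)
open import Data.Sum.Function.Propositional using (_⊎-↔_)
open import Data.Unit using (tt)
open import Function using (case_of_)
open import Function.Bundles using (_↔_; mk↔ₛ′)
open import Function.Properties.Inverse using (↔-refl; ↔-sym; ↔-trans)
open import Relation.Binary.Construct.Closure.ReflexiveTransitive using (ε; _◅_)
open import Relation.Binary.Definitions using (DecidableEquality; tri<; tri≈; tri>)
open import Relation.Binary.PropositionalEquality
  using (_≡_; _≢_; refl; sym; trans; cong; cong₂; subst; subst₂; module ≡-Reasoning)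
open import Relation.Nullary using (¬_; Dec; yes; no; ¬?)
open import Relation.Nullary.Decidable using (map′; recompute; _×-dec_)
open import Relation.Unary using (Decidable)

Subtype : (A : Set) → (A → Set) → Set
Subtype A P = Σ A λ a → Irrelevant (P a)

Subtype-≡ : ∀ {A : Set} {P : A → Set} {a b} {p : Irrelevant (P a)} {q : Irrelevant (P b)} →
  a ≡ b → _≡_ {A = Subtype A P} (a , p) (b , q)
Subtype-≡ refl = refl

module _ {A : Set} {P : A → Set} where

  Subtype-cong : ∀ {Q : A → Set} → (∀ {a} → P a → Q a) → (∀ {a} → Q a → P a) → Subtype A P ↔ Subtype A Q
  Subtype-cong to from =
    mk↔ₛ′ (λ { (a , [ p ]) → a , [ to p ] }) (λ { (a , [ q ]) → a , [ from q ] }) (λ _ → refl) (λ _ → refl)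

  Subtype-↔ : ∀ {B : Set} {Q : B → Set} → (∀ a → Dec (P a)) → (∀ b → Dec (Q b)) →
    (f : A → B) (g : B → A) → (∀ {a} → P a → Q (f a)) → (∀ {b} → Q b → P (g b)) →
    (∀ {a} → P a → g (f a) ≡ a) → (∀ {b} → Q b → f (g b) ≡ b) → Subtype A P ↔ Subtype B Q
  Subtype-↔ P? Q? f g f-resp g-resp gf fg = mk↔ₛ′
    (λ { (a , [ p ]) → f a , [ f-resp p ] })
    (λ { (b , [ q ]) → g b , [ g-resp q ] })
    (λ { (b , [ q ]) → Subtype-≡ (fg (recompute (Q? b) q)) })
    (λ { (a , [ p ]) → Subtype-≡ (gf (recompute (P? a) p)) })

index-∈-lookup : ∀ {A : Set} (L : List A) (i : Fin (length L)) → index (∈-lookup {xs = L} i) ≡ i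
index-∈-lookup (a ∷ L) zero = refl
index-∈-lookup (a ∷ L) (suc i) = cong suc (index-∈-lookup L i)

module _ {A : Set} (_≟_ : DecidableEquality A) where

  Subtype-∈↔Fin-length : (L : List A) → Unique L → Subtype A (_∈ L) ↔ Fin (length L)
  Subtype-∈↔Fin-length L uniq = mk↔ₛ′ position entry position-entry entry-position
    where
      position : Subtype A (_∈ L) → Fin (length L)
      position (a , [ a∈L ]) = index (recompute (∈-dec _≟_ a L) a∈L)
      entry : Fin (length L) → Subtype A (_∈ L)
      entry i = lookup L i , [ ∈-lookup i ]
      position-entry : ∀ i → position (entry i) ≡ i
      position-entry i = trans (cong index (unique⇒irrelevant uniq _ _)) (index-∈-lookup L i)
      entry-position : ∀ s → entry (position s) ≡ s
      entry-position (a , [ a∈L ]) = Subtype-≡ (sym (lookup-index (recompute (∈-dec _≟_ a L) a∈L)))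

  Subtype-Fin-length : ∀ {P : A → Set} (L : List A) → Unique L →
    (∀ {a} → a ∈ L → P a) → (∀ {a} → P a → a ∈ L) → Subtype A P ↔ Fin (length L)
  Subtype-Fin-length L uniq sound complete =
    ↔-trans (Subtype-cong complete sound) (Subtype-∈↔Fin-length L uniq)

#true : List Bool → ℕ
#true [] = 0
#true (true ∷ r) = suc (#true r)
#true (false ∷ r) = #true r

Choices : ℕ → ℕ → Set
Choices L k = Subtype (List Bool) λ r → length r ≡ L × #true r ≡ k

Choices↔Fin[C] : ∀ L k → Choices L k ↔ Fin (L C k)
Choices↔Fin[C] zero zero = mk↔ₛ′ (λ _ → zero) (λ _ → [] , [ refl , refl ]) (λ { zero → refl }) only
  where
    only : ∀ c → ([] , [ refl , refl ]) ≡ c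
    only ([] , _) = refl
    only ((_ ∷ _) , [ p ]) = ⊥-elim-irr (1+n≢0 (proj₁ p))
Choices↔Fin[C] zero (suc k) = mk↔ₛ′ none (λ ()) (λ ()) (λ c → none c)
  where
    none : ∀ {X : Set} → Choices 0 (suc k) → X
    none ([] , [ p ]) = ⊥-elim-irr (0≢1+n (proj₂ p))
    none ((_ ∷ _) , [ p ]) = ⊥-elim-irr (1+n≢0 (proj₁ p))
Choices↔Fin[C] (suc L) zero = ↔-trans (mk↔ₛ′ tail cons (λ _ → refl) cons-tail) (Choices↔Fin[C] L zero)
  where
    tail : Choices (suc L) 0 → Choices L 0
    tail ([] , [ p ]) = ⊥-elim-irr (0≢1+n (proj₁ p))
    tail ((true ∷ _) , [ p ]) = ⊥-elim-irr (1+n≢0 (proj₂ p))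
    tail ((false ∷ r) , [ p ]) = r , [ suc-injective (proj₁ p) , proj₂ p ]
    cons : Choices L 0 → Choices (suc L) 0
    cons (r , [ p ]) = (false ∷ r) , [ cong suc (proj₁ p) , proj₂ p ]
    cons-tail : ∀ c → cons (tail c) ≡ c
    cons-tail ([] , [ p ]) = ⊥-elim-irr (0≢1+n (proj₁ p))
    cons-tail ((true ∷ _) , [ p ]) = ⊥-elim-irr (1+n≢0 (proj₂ p))
    cons-tail ((false ∷ r) , _) = refl
Choices↔Fin[C] (suc L) (suc k) = subst (λ c → Choices (suc L) (suc k) ↔ Fin c) (nCk+nC[k+1]≡[n+1]C[k+1] L k)
  (↔-trans (mk↔ₛ′ uncons cons uncons-cons cons-uncons)
  (↔-trans (Choices↔Fin[C] L k ⊎-↔ Choices↔Fin[C] L (suc k)) (↔-sym +↔⊎)))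
  where
    uncons : Choices (suc L) (suc k) → Choices L k ⊎ Choices L (suc k)
    uncons ([] , [ p ]) = ⊥-elim-irr (0≢1+n (proj₁ p))
    uncons ((true ∷ r) , [ p ]) = inj₁ (r , [ suc-injective (proj₁ p) , suc-injective (proj₂ p) ])
    uncons ((false ∷ r) , [ p ]) = inj₂ (r , [ suc-injective (proj₁ p) , proj₂ p ])
    cons : Choices L k ⊎ Choices L (suc k) → Choices (suc L) (suc k)
    cons (inj₁ (r , [ p ])) = (true ∷ r) , [ cong suc (proj₁ p) , cong suc (proj₂ p) ]
    cons (inj₂ (r , [ p ])) = (false ∷ r) , [ cong suc (proj₁ p) , proj₂ p ]
    uncons-cons : ∀ c → uncons (cons c) ≡ c
    uncons-cons (inj₁ _) = refl
    uncons-cons (inj₂ _) = refl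
    cons-uncons : ∀ c → cons (uncons c) ≡ c
    cons-uncons ([] , [ p ]) = ⊥-elim-irr (0≢1+n (proj₁ p))
    cons-uncons ((true ∷ r) , _) = refl
    cons-uncons ((false ∷ r) , _) = refl

#false : List Bool → ℕ
#false [] = 0
#false (true ∷ r) = #false r
#false (false ∷ r) = suc (#false r)

#false+#true : ∀ r → #false r + #true r ≡ length r
#false+#true [] = refl
#false+#true (true ∷ r) = trans (+-suc (#false r) (#true r)) (cong suc (#false+#true r))
#false+#true (false ∷ r) = cong suc (#false+#true r)

#true-++ : ∀ r s → #true (r ++ s) ≡ #true r + #true s
#true-++ [] s = refl
#true-++ (true ∷ r) s = cong suc (#true-++ r s)
#true-++ (false ∷ r) s = #true-++ r s

∸-both : ∀ p q a {k l} → p + a ≡ k → q + a ≡ l → p + q ≡ k + l ∸ (a + a)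
∸-both p q a refl refl = sym (trans (cong (_∸ (a + a)) (interchange p a q a)) (m+n∸n≡m (p + q) (a + a)))

module _ {A : Set} where

  data _≺⟨_⟩_ : A → List A → A → Set where
    ≺-here  : ∀ {a b} {w : List A} → b ∈ w → a ≺⟨ a ∷ w ⟩ b
    ≺-there : ∀ {a b c} {w : List A} → a ≺⟨ w ⟩ b → a ≺⟨ c ∷ w ⟩ b

  ∉-head : ∀ {a : A} {w} → All (a ≢_) w → a ∉ w
  ∉-head (a≢b ∷ _) (here refl) = a≢b refl
  ∉-head (_ ∷ h) (there a∈w) = ∉-head h a∈w

  ≺-∈ˡ : ∀ {a b w} → a ≺⟨ w ⟩ b → a ∈ w
  ≺-∈ˡ (≺-here _) = here refl
  ≺-∈ˡ (≺-there p) = there (≺-∈ˡ p)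

  ≺-∈ʳ : ∀ {a b w} → a ≺⟨ w ⟩ b → b ∈ w
  ≺-∈ʳ (≺-here q) = there q
  ≺-∈ʳ (≺-there p) = there (≺-∈ʳ p)

  ≺-total : ∀ {a b w} → a ∈ w → b ∈ w → a ≢ b → a ≺⟨ w ⟩ b ⊎ b ≺⟨ w ⟩ a
  ≺-total (here refl) (here refl) a≢b = ⊥-elim (a≢b refl)
  ≺-total (here refl) (there q) _ = inj₁ (≺-here q)
  ≺-total (there p) (here refl) _ = inj₂ (≺-here p)
  ≺-total (there p) (there q) a≢b with ≺-total p q a≢b
  ... | inj₁ r = inj₁ (≺-there r)
  ... | inj₂ r = inj₂ (≺-there r)

  ≺-asym : ∀ {a b w} → Unique w → a ≺⟨ w ⟩ b → ¬ b ≺⟨ w ⟩ a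
  ≺-asym (h ∷ _) (≺-here q) (≺-here r) = ∉-head h r
  ≺-asym (h ∷ _) (≺-here q) (≺-there r) = ∉-head h (≺-∈ʳ r)
  ≺-asym (h ∷ _) (≺-there p) (≺-here r) = ∉-head h (≺-∈ʳ p)
  ≺-asym (_ ∷ u) (≺-there p) (≺-there r) = ≺-asym u p r

  ≺-trans : ∀ {a b c w} → Unique w → a ≺⟨ w ⟩ b → b ≺⟨ w ⟩ c → a ≺⟨ w ⟩ c
  ≺-trans (h ∷ _) (≺-here q) (≺-here r) = ⊥-elim (∉-head h q)
  ≺-trans (h ∷ _) (≺-here q) (≺-there r) = ≺-here (≺-∈ʳ r)
  ≺-trans (h ∷ _) (≺-there p) (≺-here r) = ⊥-elim (∉-head h (≺-∈ʳ p))
  ≺-trans (_ ∷ u) (≺-there p) (≺-there r) = ≺-there (≺-trans u p r)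

  ≺-resolve : ∀ {a b w} → a ∈ w → b ∈ w → a ≢ b → ¬ b ≺⟨ w ⟩ a → a ≺⟨ w ⟩ b
  ≺-resolve a∈w b∈w a≢b b⊀a with ≺-total a∈w b∈w a≢b
  ... | inj₁ a≺b = a≺b
  ... | inj₂ b≺a = ⊥-elim (b⊀a b≺a)

  AllPairs⇒≺ : ∀ {R : A → A → Set} {w a b} → AllPairs R w → a ≺⟨ w ⟩ b → R a b
  AllPairs⇒≺ (h ∷ _) (≺-here q) = All.lookup h q
  AllPairs⇒≺ (_ ∷ hs) (≺-there p) = AllPairs⇒≺ hs p

  ≺⇒AllPairs : ∀ {R : A → A → Set} {w} → (∀ {a b} → a ≺⟨ w ⟩ b → R a b) → AllPairs R w
  ≺⇒AllPairs {w = []} _ = []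
  ≺⇒AllPairs {w = _ ∷ _} r = All.tabulate (λ q → r (≺-here q)) ∷ ≺⇒AllPairs (λ p → r (≺-there p))

  ≺-ext : ∀ {u v} → Unique u → Unique v → (∀ {c} → c ∈ u → c ∈ v) → (∀ {c} → c ∈ v → c ∈ u) →
    (∀ {a b} → a ≺⟨ u ⟩ b → a ≺⟨ v ⟩ b) → u ≡ v
  ≺-ext {[]} {[]} _ _ _ _ _ = refl
  ≺-ext {[]} {_ ∷ _} _ _ _ v⊆u _ with v⊆u (here refl)
  ... | ()
  ≺-ext {_ ∷ _} {[]} _ _ u⊆v _ _ with u⊆v (here refl)
  ... | ()
  ≺-ext {a ∷ u} {b ∷ v} (hu ∷ uu) (hv ∷ uv) u⊆v v⊆u ≺⇒≺ with u⊆v (here refl)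
  ... | here refl = cong (a ∷_) (≺-ext uu uv (tail-⊆ hu u⊆v) (tail-⊆ hv v⊆u) tail-≺)
    where
      tail-⊆ : ∀ {a s t} → All (a ≢_) s → (∀ {c} → c ∈ a ∷ s → c ∈ a ∷ t) → ∀ {c} → c ∈ s → c ∈ t
      tail-⊆ h s⊆t c∈s with s⊆t (there c∈s)
      ... | here refl = ⊥-elim (∉-head h c∈s)
      ... | there c∈t = c∈t
      tail-≺ : ∀ {c d} → c ≺⟨ u ⟩ d → c ≺⟨ v ⟩ d
      tail-≺ c≺d with ≺⇒≺ (≺-there c≺d)
      ... | ≺-here _ = ⊥-elim (∉-head hu (≺-∈ˡ c≺d))
      ... | ≺-there c≺′d = c≺′d
  ... | there a∈v = ⊥-elim (not-before-head (≺⇒≺ (≺-here b∈u)))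
    where
      b∈u : b ∈ u
      b∈u with v⊆u (here refl)
      ... | here refl = ⊥-elim (∉-head hv a∈v)
      ... | there b∈u = b∈u
      not-before-head : ¬ a ≺⟨ b ∷ v ⟩ b
      not-before-head (≺-here _) = ∉-head hv a∈v
      not-before-head (≺-there a≺b) = ∉-head hv (≺-∈ʳ a≺b)

  ∈-insert⁻ : ∀ (p : List A) {c s e} → e ∈ p ++ c ∷ s → e ≡ c ⊎ e ∈ p ++ s
  ∈-insert⁻ [] (here e≡c) = inj₁ e≡c
  ∈-insert⁻ [] (there e∈s) = inj₂ e∈s
  ∈-insert⁻ (_ ∷ p) (here e≡d) = inj₂ (here e≡d)
  ∈-insert⁻ (_ ∷ p) (there q) with ∈-insert⁻ p q
  ... | inj₁ e≡c = inj₁ e≡c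
  ... | inj₂ r = inj₂ (there r)

  ∈-insert⁺ : ∀ (p : List A) {c s e} → e ∈ p ++ s → e ∈ p ++ c ∷ s
  ∈-insert⁺ [] q = there q
  ∈-insert⁺ (_ ∷ p) (here e≡d) = here e≡d
  ∈-insert⁺ (_ ∷ p) (there q) = there (∈-insert⁺ p q)

  ∈-swap : ∀ (p : List A) {c d s e} → e ∈ p ++ c ∷ d ∷ s → e ∈ p ++ d ∷ c ∷ s
  ∈-swap [] (here e≡c) = there (here e≡c)
  ∈-swap [] (there (here e≡d)) = here e≡d
  ∈-swap [] (there (there q)) = there (there q)
  ∈-swap (_ ∷ p) (here e≡f) = here e≡f
  ∈-swap (_ ∷ p) (there q) = there (∈-swap p q)

  Unique-insert⇒∉ : ∀ (p : List A) {c s} → Unique (p ++ c ∷ s) → c ∉ p ++ s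
  Unique-insert⇒∉ [] (h ∷ _) = ∉-head h
  Unique-insert⇒∉ (_ ∷ p) (h ∷ _) (here refl) = ∉-head h (∈-insert p)
  Unique-insert⇒∉ (_ ∷ p) (_ ∷ u) (there q) = Unique-insert⇒∉ p u q

  ≺-++⁺ʳ : ∀ (p : List A) {s a b} → a ≺⟨ s ⟩ b → a ≺⟨ p ++ s ⟩ b
  ≺-++⁺ʳ [] q = q
  ≺-++⁺ʳ (_ ∷ p) q = ≺-there (≺-++⁺ʳ p q)

  ≺-insert⁻ : ∀ (p : List A) {c s a b} → a ≺⟨ p ++ c ∷ s ⟩ b → a ≢ c → b ≢ c → a ≺⟨ p ++ s ⟩ b
  ≺-insert⁻ [] (≺-here _) a≢c _ = ⊥-elim (a≢c refl)
  ≺-insert⁻ [] (≺-there q) _ _ = q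
  ≺-insert⁻ (_ ∷ p) (≺-here q) _ b≢c with ∈-insert⁻ p q
  ... | inj₁ b≡c = ⊥-elim (b≢c b≡c)
  ... | inj₂ b∈ = ≺-here b∈
  ≺-insert⁻ (_ ∷ p) (≺-there q) a≢c b≢c = ≺-there (≺-insert⁻ p q a≢c b≢c)

  ≺-insert⁺ : ∀ (p : List A) {c s a b} → a ≺⟨ p ++ s ⟩ b → a ≺⟨ p ++ c ∷ s ⟩ b
  ≺-insert⁺ [] q = ≺-there q
  ≺-insert⁺ (_ ∷ p) (≺-here q) = ≺-here (∈-insert⁺ p q)
  ≺-insert⁺ (_ ∷ p) (≺-there q) = ≺-there (≺-insert⁺ p q)

  ≺-swap : ∀ (p : List A) {c d s a b} → a ≺⟨ p ++ c ∷ d ∷ s ⟩ b → (a ≡ c × b ≡ d) ⊎ a ≺⟨ p ++ d ∷ c ∷ s ⟩ b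
  ≺-swap [] (≺-here (here b≡d)) = inj₁ (refl , b≡d)
  ≺-swap [] (≺-here (there q)) = inj₂ (≺-there (≺-here q))
  ≺-swap [] (≺-there (≺-here q)) = inj₂ (≺-here (there q))
  ≺-swap [] (≺-there (≺-there q)) = inj₂ (≺-there (≺-there q))
  ≺-swap (_ ∷ p) (≺-here q) = inj₂ (≺-here (∈-swap p q))
  ≺-swap (_ ∷ p) (≺-there q) with ≺-swap p q
  ... | inj₁ e = inj₁ e
  ... | inj₂ r = inj₂ (≺-there r)

  ≺-insert⇒∈-suffix : ∀ (p : List A) {a s b} → Unique (p ++ a ∷ s) → a ≺⟨ p ++ a ∷ s ⟩ b → b ∈ s
  ≺-insert⇒∈-suffix [] _ (≺-here q) = q
  ≺-insert⇒∈-suffix [] (h ∷ _) (≺-there q) = ⊥-elim (∉-head h (≺-∈ˡ q))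
  ≺-insert⇒∈-suffix (_ ∷ p) (h ∷ _) (≺-here _) = ⊥-elim (∉-head h (∈-insert p))
  ≺-insert⇒∈-suffix (_ ∷ p) (_ ∷ u) (≺-there q) = ≺-insert⇒∈-suffix p u q

  AllPairs-delete : ∀ {R : A → A → Set} (p : List A) {c s} → AllPairs R (p ++ c ∷ s) → AllPairs R (p ++ s)
  AllPairs-delete p h = ≺⇒AllPairs (λ q → AllPairs⇒≺ h (≺-insert⁺ p q))

  AllPairs-swap : ∀ {R : A → A → Set} (p : List A) {c d s} → AllPairs R (p ++ c ∷ d ∷ s) → R d c →
    AllPairs R (p ++ d ∷ c ∷ s)
  AllPairs-swap {R} p {c} {d} {s} h rdc = ≺⇒AllPairs swapped
    where
      swapped : ∀ {a b} → a ≺⟨ p ++ d ∷ c ∷ s ⟩ b → R a b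
      swapped q with ≺-swap p q
      ... | inj₁ (refl , refl) = rdc
      ... | inj₂ r = AllPairs⇒≺ h r
  ++-∷-≢ : ∀ (p : List A) {c s} → p ++ s ≢ p ++ c ∷ s
  ++-∷-≢ p {c} {s} eq = m≢1+n+m (length (p ++ s)) {0} (trans (cong length eq) (length-++-sucʳ p c s))

  filter-cong-∈ : ∀ {P Q : A → Set} (P? : Decidable P) (Q? : Decidable Q) is →
    (∀ {i} → i ∈ is → (P i → Q i) × (Q i → P i)) → filter P? is ≡ filter Q? is
  filter-cong-∈ P? Q? [] _ = refl
  filter-cong-∈ P? Q? (i ∷ is) P⇔Q with P? i
  ... | yes Pi =
      trans (cong (i ∷_) (filter-cong-∈ P? Q? is (λ q → P⇔Q (there q))))
      (sym (filter-accept Q? (proj₁ (P⇔Q (here refl)) Pi)))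
  ... | no ¬Pi =
      trans (filter-cong-∈ P? Q? is (λ q → P⇔Q (there q)))
      (sym (filter-reject Q? (λ Qi → ¬Pi (proj₂ (P⇔Q (here refl)) Qi))))

  Unique-++⁻ʳ : ∀ (p : List A) {q} → Unique (p ++ q) → Unique q
  Unique-++⁻ʳ [] u = u
  Unique-++⁻ʳ (_ ∷ p) (_ ∷ u) = Unique-++⁻ʳ p u

  Unique-++-disjoint : ∀ (p : List A) {q a} → Unique (p ++ q) → a ∈ p → a ∉ q
  Unique-++-disjoint (_ ∷ p) (h ∷ _) (here refl) a∈q = ∉-head h (∈-++⁺ʳ p a∈q)
  Unique-++-disjoint (_ ∷ p) (_ ∷ u) (there a∈p) = Unique-++-disjoint p u a∈p

module _ {A B : Set} where

  Unique-map-injectiveOn : ∀ (f : A → B) {L} → (∀ {a b} → a ∈ L → b ∈ L → a ≢ b → f a ≢ f b) →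
    Unique L → Unique (map f L)
  Unique-map-injectiveOn f f-inj uL =
    AllPairsₚ.map⁺ (≺⇒AllPairs (λ a≺b → f-inj (≺-∈ˡ a≺b) (≺-∈ʳ a≺b) (AllPairs⇒≺ uL a≺b)))

Sorted : ∀ {k} → List (Fin k) → Set
Sorted = AllPairs _<ᶠ_

module _ {A : Set} (_≟_ : DecidableEquality A) where

  cut : A → List A → List A × List A
  cut k [] = [] , []
  cut k (i ∷ is) with i ≟ k
  ... | yes _ = [] , is
  ... | no _ = let (pre , post) = cut k is in i ∷ pre , post

  cut-⊆ : ∀ {k ks} is → k ∷ ks ⊆ is → let (pre , post) = cut k is in is ≡ pre ++ k ∷ post × ks ⊆ post × All (_≢ k) pre
  cut-⊆ {k} (i ∷ is) sub with i ≟ k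
  ... | yes refl = refl , ∷⁻ sub , []
  ... | no i≢k with cut-⊆ is (∷ʳ⁻ (λ k≡i → i≢k (sym k≡i)) sub)
  ...   | eq , sub′ , pre≢k = cong (i ∷_) eq , sub′ , i≢k ∷ pre≢k

  cut-⊆-rest : ∀ {k ks} is → k ∷ ks ⊆ is → ks ⊆ proj₂ (cut k is)
  cut-⊆-rest is sub = proj₁ (proj₂ (cut-⊆ is sub))

  cut-Unique : ∀ {k ks} is → Unique is → k ∷ ks ⊆ is → Unique (proj₂ (cut k is)) × k ∉ proj₂ (cut k is)
  cut-Unique {k} is uniq sub = AllPairs.tail k∷post , ∉-head (AllPairs.head k∷post)
    where
      k∷post : Unique (k ∷ proj₂ (cut k is))
      k∷post = Unique-++⁻ʳ (proj₁ (cut k is)) (subst Unique (proj₁ (cut-⊆ is sub)) uniq)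

  cut-self : ∀ k is → cut k (k ∷ is) ≡ ([] , is)
  cut-self k is with k ≟ k
  ... | yes _ = refl
  ... | no k≢k = ⊥-elim (k≢k refl)

  cut-other : ∀ k i is → i ≢ k → cut k (i ∷ is) ≡ (i ∷ proj₁ (cut k is) , proj₂ (cut k is))
  cut-other k i is i≢k with i ≟ k
  ... | yes i≡k = ⊥-elim (i≢k i≡k)
  ... | no _ = refl

module _ {k : ℕ} where

  sorted-⊆ : ∀ {ks L : List (Fin k)} → Sorted ks → Sorted L → (∀ {a} → a ∈ ks → a ∈ L) → ks ⊆ L
  sorted-⊆ {[]} {L} _ _ _ = Sublist.minimum L
  sorted-⊆ {_ ∷ _} {[]} _ _ ks⊆L with ks⊆L (here refl)
  ... | ()
  sorted-⊆ {a ∷ ks} {l ∷ L} (a< ∷ sk) (l< ∷ sL) ks⊆L with a ≟ᶠ l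
  ... | yes refl = refl ∷ sorted-⊆ sk sL tail⊆
    where
      tail⊆ : ∀ {b} → b ∈ ks → b ∈ L
      tail⊆ b∈ks with ks⊆L (there b∈ks)
      ... | here refl = ⊥-elim (<-irrefl refl (All.lookup a< b∈ks))
      ... | there b∈L = b∈L
  ... | no a≢l = l ∷ʳ sorted-⊆ (a< ∷ sk) sL tail⊆
    where
      a∈L : a ∈ L
      a∈L with ks⊆L (here refl)
      ... | here a≡l = ⊥-elim (a≢l a≡l)
      ... | there a∈L = a∈L
      tail⊆ : ∀ {b} → b ∈ a ∷ ks → b ∈ L
      tail⊆ (here refl) = a∈L
      tail⊆ (there b∈ks) with ks⊆L (there b∈ks)
      ... | here refl = ⊥-elim (<-asym (All.lookup a< b∈ks) (All.lookup l< a∈L))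
      ... | there b∈L = b∈L

  <⇒∉ : ∀ {i : Fin k} {is} → All (i <ᶠ_) is → i ∉ is
  <⇒∉ i< i∈ = <-irrefl refl (All.lookup i< i∈)

allFin-sorted : ∀ k → Sorted (allFin k)
allFin-sorted k = AllPairsₚ.tabulate⁺-< (λ i<j → i<j)

-- Shuffle words and the invariant of the bubble order

module _ {m n : ℕ} where

  x-injective : ∀ {i k : Fin m} → x {n = n} i ≡ x k → i ≡ k
  x-injective refl = refl

  y-injective : ∀ {j l : Fin n} → y {m} j ≡ y l → j ≡ l
  y-injective refl = refl

  _≟ₗ_ : DecidableEquality (Letter m n)
  x i ≟ₗ x k = map′ (cong x) x-injective (i ≟ᶠ k)
  x _ ≟ₗ y _ = no (λ ())
  y _ ≟ₗ x _ = no (λ ())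
  y j ≟ₗ y l = map′ (cong y) y-injective (j ≟ᶠ l)

  Before⇒≢ : ∀ {a b : Letter m n} → Before a b → a ≢ b
  Before⇒≢ {x i} i<i refl = <-irrefl refl i<i
  Before⇒≢ {y j} j<j refl = <-irrefl refl j<j

  Before? : ∀ (a b : Letter m n) → Dec (Before a b)
  Before? (x i) (x k) = i <? k
  Before? (x _) (y _) = yes tt
  Before? (y _) (x _) = yes tt
  Before? (y j) (y l) = j <? l

  Shuffled : Word m n → Set
  Shuffled = AllPairs Before

  Shuffled⇒Unique : ∀ {w} → Shuffled w → Unique w
  Shuffled⇒Unique = AllPairs.map Before⇒≢

  Shuffled⇒IsShuf : ∀ {w} → Shuffled w → IsShuf w
  Shuffled⇒IsShuf s = Shuffled⇒Unique s , s

  shuffled-order : ∀ {w a b} → Shuffled w → a ∈ w → b ∈ w → Before a b → ¬ Before b a → a ≺⟨ w ⟩ b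
  shuffled-order sw a∈w b∈w a<b b≮a = ≺-resolve a∈w b∈w (Before⇒≢ a<b) (λ b≺a → b≮a (AllPairs⇒≺ sw b≺a))

  shuffled-≡ : ∀ {u v} → Shuffled u → Shuffled v →
    (∀ {c} → c ∈ u → c ∈ v) → (∀ {c} → c ∈ v → c ∈ u) →
    (∀ {i j} → y j ≺⟨ u ⟩ x i → y j ≺⟨ v ⟩ x i) → (∀ {i j} → y j ≺⟨ v ⟩ x i → y j ≺⟨ u ⟩ x i) → u ≡ v
  shuffled-≡ {u} {v} su sv u⊆v v⊆u yx⇒ ⇐yx = ≺-ext (Shuffled⇒Unique su) (Shuffled⇒Unique sv) u⊆v v⊆u ≺⇒≺
    where
      forced : ∀ {a b} → a ≺⟨ u ⟩ b → Before a b → ¬ Before b a → a ≺⟨ v ⟩ b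
      forced a≺b = shuffled-order sv (u⊆v (≺-∈ˡ a≺b)) (u⊆v (≺-∈ʳ a≺b))
      ≺⇒≺ : ∀ {a b} → a ≺⟨ u ⟩ b → a ≺⟨ v ⟩ b
      ≺⇒≺ {x _} {x _} a≺b = forced a≺b (AllPairs⇒≺ su a≺b) (<-asym (AllPairs⇒≺ su a≺b))
      ≺⇒≺ {y _} {y _} a≺b = forced a≺b (AllPairs⇒≺ su a≺b) (<-asym (AllPairs⇒≺ su a≺b))
      ≺⇒≺ {y _} {x _} a≺b = yx⇒ a≺b
      ≺⇒≺ {x _} {y _} a≺b = ≺-resolve (u⊆v (≺-∈ˡ a≺b)) (u⊆v (≺-∈ʳ a≺b)) (λ ())
        (λ b≺a → ≺-asym (Shuffled⇒Unique su) a≺b (⇐yx b≺a))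

  -- Going up in the bubble order only deletes x's, only inserts y's, and never moves a y behind a surviving x.
  record _⊴_ (u v : Word m n) : Set where
    field
      x-reflected : ∀ {i} → x i ∈ v → x i ∈ u
      y-preserved : ∀ {j} → y j ∈ u → y j ∈ v
      yx-preserved : ∀ {i j} → x i ∈ v → y j ≺⟨ u ⟩ x i → y j ≺⟨ v ⟩ x i
  open _⊴_ public

  ⊴-refl : ∀ {u} → u ⊴ u
  ⊴-refl = record { x-reflected = λ p → p ; y-preserved = λ p → p ; yx-preserved = λ _ p → p }

  ⊴-trans : ∀ {u v w} → u ⊴ v → v ⊴ w → u ⊴ w
  ⊴-trans u⊴v v⊴w = record
    { x-reflected = λ p → x-reflected u⊴v (x-reflected v⊴w p)
    ; y-preserved = λ p → y-preserved v⊴w (y-preserved u⊴v p)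
    ; yx-preserved = λ p q → yx-preserved v⊴w p (yx-preserved u⊴v (x-reflected v⊴w p) q) }

  Move⇒⊴ : ∀ {u v} → Move u v → u ⊴ v
  Move⇒⊴ ((uniq , _) , _ , inj₁ (del p s i)) = record
    { x-reflected = ∈-insert⁺ p
    ; y-preserved = λ q → survivor (∈-insert⁻ p q)
    ; yx-preserved = λ xk∈ q → ≺-insert⁻ p q (λ ()) (λ { refl → Unique-insert⇒∉ p uniq xk∈ }) }
    where
      survivor : ∀ {j} → y j ≡ x i ⊎ y j ∈ p ++ s → y j ∈ p ++ s
      survivor (inj₁ ())
      survivor (inj₂ q) = q
  Move⇒⊴ (_ , _ , inj₁ (ins p s j)) = record
    { x-reflected = λ q → survivor (∈-insert⁻ p q)
    ; y-preserved = ∈-insert⁺ p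
    ; yx-preserved = λ _ → ≺-insert⁺ p }
    where
      survivor : ∀ {i} → x i ≡ y j ⊎ x i ∈ p ++ s → x i ∈ p ++ s
      survivor (inj₁ ())
      survivor (inj₂ q) = q
  Move⇒⊴ (_ , _ , inj₂ (swap p s i j)) = record
    { x-reflected = ∈-swap p
    ; y-preserved = ∈-swap p
    ; yx-preserved = λ _ q → unswapped (≺-swap p q) }
    where
      unswapped : ∀ {k l} → (y l ≡ x i × x k ≡ y j) ⊎ y l ≺⟨ p ++ y j ∷ x i ∷ s ⟩ x k →
        y l ≺⟨ p ++ y j ∷ x i ∷ s ⟩ x k
      unswapped (inj₁ (() , _))
      unswapped (inj₂ q) = q

  ≤B⇒⊴ : ∀ {u v} → u ≤B v → u ⊴ v
  ≤B⇒⊴ ε = ⊴-refl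
  ≤B⇒⊴ (mv ◅ mvs) = ⊴-trans (Move⇒⊴ mv) (≤B⇒⊴ mvs)

-- Lower covers

module _ {m n : ℕ} where

  data YOrEnd : Word m n → Set where
    end : YOrEnd []
    y-next : ∀ {j s} → YOrEnd (y j ∷ s)

  data XOrEnd : Word m n → Set where
    end : XOrEnd []
    x-next : ∀ {i s} → XOrEnd (x i ∷ s)

  single-move : ∀ {u v : Word m n} → Shuffled u → Shuffled v → Step u v → u ≤B v
  single-move su sv step = (Shuffled⇒IsShuf su , Shuffled⇒IsShuf sv , step) ◅ ε

  cover-by-move : ∀ {v u : Word m n} → Shuffled v → Shuffled u → Step v u → v ≢ u →
    (∀ w → Shuffled w → v ⊴ w → w ⊴ u → w ≡ v ⊎ w ≡ u) → LowerCover v u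
  cover-by-move sv su step v≢u between =
    Shuffled⇒IsShuf sv , Shuffled⇒IsShuf su , single-move sv su step , v≢u ,
    λ w (_ , sw) v≤w w≤u → between w sw (≤B⇒⊴ v≤w) (≤B⇒⊴ w≤u)

  letters-⊆ : ∀ {u v : Word m n} → (∀ {i} → x i ∈ u → x i ∈ v) → (∀ {j} → y j ∈ u → y j ∈ v) →
    ∀ {c} → c ∈ u → c ∈ v
  letters-⊆ xs _ {x _} = xs
  letters-⊆ _ ys {y _} = ys

  swap-cover : ∀ p s i j → Shuffled (p ++ y j ∷ x i ∷ s) →
    LowerCover (p ++ x i ∷ y j ∷ s) (p ++ y j ∷ x i ∷ s)
  swap-cover p s i j su =
    cover-by-move sv su (inj₂ (swap p s i j)) (λ eq → xy≢yx (++-cancelˡ p (x i ∷ y j ∷ s) _ eq)) between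
    where
      v = p ++ x i ∷ y j ∷ s
      u = p ++ y j ∷ x i ∷ s
      sv : Shuffled v
      sv = AllPairs-swap p su tt
      xy≢yx : ¬ _≡_ {A = Word m n} (x i ∷ y j ∷ s) (y j ∷ x i ∷ s)
      xy≢yx ()
      between : ∀ w → Shuffled w → v ⊴ w → w ⊴ u → w ≡ v ⊎ w ≡ u
      between w sw v⊴w w⊴u = by-order (≺-total yj∈w xi∈w (λ ()))
        where
          yj∈w = y-preserved v⊴w (∈-swap p (∈-insert p))
          xi∈w = x-reflected w⊴u (∈-swap p (∈-insert p))
          w⊆v : ∀ {c} → c ∈ w → c ∈ v
          w⊆v = letters-⊆ (x-reflected v⊴w) (λ q → ∈-swap p (y-preserved w⊴u q))
          v⊆w : ∀ {c} → c ∈ v → c ∈ w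
          v⊆w = letters-⊆ (λ q → x-reflected w⊴u (∈-swap p q)) (y-preserved v⊴w)
          by-order : y j ≺⟨ w ⟩ x i ⊎ x i ≺⟨ w ⟩ y j → w ≡ v ⊎ w ≡ u
          by-order (inj₁ yj≺xi) = inj₂ (shuffled-≡ sw su (λ q → ∈-swap p (w⊆v q)) (λ q → v⊆w (∈-swap p q))
            (λ q → yx-preserved w⊴u (∈-swap p (w⊆v (≺-∈ʳ q))) q) u⇒w)
            where
              u⇒w : ∀ {k l} → y l ≺⟨ u ⟩ x k → y l ≺⟨ w ⟩ x k
              u⇒w q with ≺-swap p q
              ... | inj₁ (refl , refl) = yj≺xi
              ... | inj₂ r = yx-preserved v⊴w (v⊆w (≺-∈ʳ r)) r
          by-order (inj₂ xi≺yj) =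
            inj₁ (shuffled-≡ sw sv w⊆v v⊆w w⇒v (λ q → yx-preserved v⊴w (v⊆w (≺-∈ʳ q)) q))
            where
              w⇒v : ∀ {k l} → y l ≺⟨ w ⟩ x k → y l ≺⟨ v ⟩ x k
              w⇒v q with ≺-swap p (yx-preserved w⊴u (∈-swap p (w⊆v (≺-∈ʳ q))) q)
              ... | inj₁ (refl , refl) = ⊥-elim (≺-asym (Shuffled⇒Unique sw) q xi≺yj)
              ... | inj₂ r = r

  -- y j is followed by some y l′ with j < l′, and y l′ precedes x k in p ++ s and hence in w.
  inserted-y-precedes : ∀ p s j {w} → YOrEnd s → Shuffled (p ++ y j ∷ s) → Shuffled w → y j ∈ w →
    (p ++ s) ⊴ w → w ⊴ (p ++ y j ∷ s) → ∀ {k} → y j ≺⟨ p ++ y j ∷ s ⟩ x k → y j ≺⟨ w ⟩ x k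
  inserted-y-precedes p s j {w} y-or-end su sw yj∈w v⊴w w⊴u {k} yj≺xk =
    via-next y-or-end (≺-insert⇒∈-suffix p (Shuffled⇒Unique su) yj≺xk)
    where
      via-next : YOrEnd s → x k ∈ s → y j ≺⟨ w ⟩ x k
      via-next (y-next {l′}) (there xk∈s′) = ≺-trans (Shuffled⇒Unique sw) yj≺yl′ yl′≺xk
        where
          j<l′ : Before (y {m} j) (y l′)
          j<l′ = AllPairs⇒≺ su (≺-++⁺ʳ p (≺-here (here refl)))
          yl′≺xk : y l′ ≺⟨ w ⟩ x k
          yl′≺xk = yx-preserved v⊴w (x-reflected w⊴u (≺-∈ʳ yj≺xk)) (≺-++⁺ʳ p (≺-here xk∈s′))
          yj≺yl′ : y j ≺⟨ w ⟩ y l′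
          yj≺yl′ = shuffled-order sw yj∈w (≺-∈ˡ yl′≺xk) j<l′ (<-asym j<l′)

  -- x i is followed by some x k′ with i < k′, and x k′ precedes y l in p ++ s and hence in w.
  deleted-x-follows : ∀ p s i {w} → XOrEnd s → Shuffled (p ++ x i ∷ s) → Shuffled w →
    w ⊴ (p ++ s) → ∀ {l} → y l ≺⟨ w ⟩ x i → y l ≺⟨ p ++ x i ∷ s ⟩ x i
  deleted-x-follows p s i {w} x-or-end sv sw w⊴u {l} yl≺xi =
    ≺-resolve (∈-insert⁺ p (y-preserved w⊴u (≺-∈ˡ yl≺xi))) (∈-insert p) (λ ())
      (λ xi≺yl → via-next x-or-end (≺-insert⇒∈-suffix p (Shuffled⇒Unique sv) xi≺yl))
    where
      via-next : XOrEnd s → y l ∉ s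
      via-next (x-next {k′}) (there yl∈s′) =
        ≺-asym (Shuffled⇒Unique sw) yl≺xi (≺-trans (Shuffled⇒Unique sw) xi≺xk′ xk′≺yl)
        where
          i<k′ : Before (x {n = n} i) (x k′)
          i<k′ = AllPairs⇒≺ sv (≺-++⁺ʳ p (≺-here (here refl)))
          xk′≺yl-in-u : x k′ ≺⟨ p ++ s ⟩ y l
          xk′≺yl-in-u = ≺-++⁺ʳ p (≺-here yl∈s′)
          xk′∈w : x k′ ∈ w
          xk′∈w = x-reflected w⊴u (≺-∈ˡ xk′≺yl-in-u)
          xk′≺yl : x k′ ≺⟨ w ⟩ y l
          xk′≺yl = ≺-resolve xk′∈w (≺-∈ˡ yl≺xi) (λ ())
            (λ yl≺xk′ →
              ≺-asym (Shuffled⇒Unique (AllPairs-delete p sv)) xk′≺yl-in-u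
              (yx-preserved w⊴u (≺-∈ˡ xk′≺yl-in-u) yl≺xk′))
          xi≺xk′ : x i ≺⟨ w ⟩ x k′
          xi≺xk′ = shuffled-order sw (≺-∈ʳ yl≺xi) xk′∈w i<k′ (<-asym i<k′)

  y-insertion-cover : ∀ p s j → YOrEnd s → Shuffled (p ++ y j ∷ s) → LowerCover (p ++ s) (p ++ y j ∷ s)
  y-insertion-cover p s j y-or-end su = cover-by-move sv su (inj₁ (ins p s j)) (++-∷-≢ p) between
    where
      v = p ++ s
      u = p ++ y j ∷ s
      sv : Shuffled v
      sv = AllPairs-delete p su
      between : ∀ w → Shuffled w → v ⊴ w → w ⊴ u → w ≡ v ⊎ w ≡ u
      between w sw v⊴w w⊴u with ∈-dec _≟ₗ_ (y j) w
      ... | no yj∉w = inj₁ (shuffled-≡ sw sv w⊆v v⊆w w⇒v (λ q → yx-preserved v⊴w (v⊆w (≺-∈ʳ q)) q))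
        where
          w⊆v : ∀ {c} → c ∈ w → c ∈ v
          w⊆v = letters-⊆ (x-reflected v⊴w) λ q → case (∈-insert⁻ p (y-preserved w⊴u q)) of λ
            { (inj₁ refl) → ⊥-elim (yj∉w q) ; (inj₂ r) → r }
          v⊆w : ∀ {c} → c ∈ v → c ∈ w
          v⊆w = letters-⊆ (λ q → x-reflected w⊴u (∈-insert⁺ p q)) (y-preserved v⊴w)
          w⇒v : ∀ {k l} → y l ≺⟨ w ⟩ x k → y l ≺⟨ v ⟩ x k
          w⇒v q = ≺-insert⁻ p (yx-preserved w⊴u (∈-insert⁺ p (w⊆v (≺-∈ʳ q))) q)
            (λ { refl → yj∉w (≺-∈ˡ q) }) (λ ())
      ... | yes yj∈w = inj₂ (shuffled-≡ sw su w⊆u u⊆w (λ q → yx-preserved w⊴u (w⊆u (≺-∈ʳ q)) q) u⇒w)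
        where
          w⊆u : ∀ {c} → c ∈ w → c ∈ u
          w⊆u = letters-⊆ (λ q → ∈-insert⁺ p (x-reflected v⊴w q)) (y-preserved w⊴u)
          u⊆w : ∀ {c} → c ∈ u → c ∈ w
          u⊆w = letters-⊆ (x-reflected w⊴u) λ q → case (∈-insert⁻ p q) of λ
            { (inj₁ refl) → yj∈w ; (inj₂ r) → y-preserved v⊴w r }
          u⇒w : ∀ {k l} → y l ≺⟨ u ⟩ x k → y l ≺⟨ w ⟩ x k
          u⇒w {k} {l} q with l ≟ᶠ j
          ... | no l≢j =
              yx-preserved v⊴w (x-reflected w⊴u (≺-∈ʳ q)) (≺-insert⁻ p q (λ eq → l≢j (y-injective eq)) (λ ()))
          ... | yes refl = inserted-y-precedes p s j y-or-end su sw yj∈w v⊴w w⊴u q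

  x-deletion-cover : ∀ p s i → XOrEnd s → Shuffled (p ++ x i ∷ s) → LowerCover (p ++ x i ∷ s) (p ++ s)
  x-deletion-cover p s i x-or-end sv =
    cover-by-move sv su (inj₁ (del p s i)) (λ eq → ++-∷-≢ p (sym eq)) between
    where
      v = p ++ x i ∷ s
      u = p ++ s
      su : Shuffled u
      su = AllPairs-delete p sv
      between : ∀ w → Shuffled w → v ⊴ w → w ⊴ u → w ≡ v ⊎ w ≡ u
      between w sw v⊴w w⊴u with ∈-dec _≟ₗ_ (x i) w
      ... | yes xi∈w = inj₁ (shuffled-≡ sw sv w⊆v v⊆w w⇒v (λ q → yx-preserved v⊴w (v⊆w (≺-∈ʳ q)) q))
        where
          w⊆v : ∀ {c} → c ∈ w → c ∈ v
          w⊆v = letters-⊆ (x-reflected v⊴w) (λ q → ∈-insert⁺ p (y-preserved w⊴u q))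
          v⊆w : ∀ {c} → c ∈ v → c ∈ w
          v⊆w = letters-⊆ (λ q → case (∈-insert⁻ p q) of λ
            { (inj₁ refl) → xi∈w ; (inj₂ r) → x-reflected w⊴u r }) (y-preserved v⊴w)
          w⇒v : ∀ {k l} → y l ≺⟨ w ⟩ x k → y l ≺⟨ v ⟩ x k
          w⇒v {k} {l} q with k ≟ᶠ i
          ... | no k≢i = ≺-insert⁺ p (yx-preserved w⊴u xk∈u q)
            where
              xk∈u : x k ∈ u
              xk∈u = case (∈-insert⁻ p (x-reflected v⊴w (≺-∈ʳ q))) of λ
                { (inj₁ eq) → ⊥-elim (k≢i (x-injective eq)) ; (inj₂ r) → r }
          ... | yes refl = deleted-x-follows p s i x-or-end sv sw w⊴u q
      ... | no xi∉w = inj₂ (shuffled-≡ sw su w⊆u u⊆w (λ q → yx-preserved w⊴u (w⊆u (≺-∈ʳ q)) q)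
                        (λ q → yx-preserved v⊴w (u⊆w (≺-∈ʳ q)) (≺-insert⁺ p q)))
        where
          w⊆u : ∀ {c} → c ∈ w → c ∈ u
          w⊆u = letters-⊆ (λ q → case (∈-insert⁻ p (x-reflected v⊴w q)) of λ
            { (inj₁ refl) → ⊥-elim (xi∉w q) ; (inj₂ r) → r }) (y-preserved w⊴u)
          u⊆w : ∀ {c} → c ∈ u → c ∈ w
          u⊆w = letters-⊆ (x-reflected w⊴u) (λ q → y-preserved v⊴w (∈-insert⁺ p q))

  insert-y-after : ∀ p (c : Letter m n) s j → IndelStep (p ++ c ∷ s) (p ++ c ∷ y j ∷ s)
  insert-y-after p c s j =
    subst₂ IndelStep (++-assoc p (c ∷ []) s) (++-assoc p (c ∷ []) (y j ∷ s)) (ins (p ++ c ∷ []) s j)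

  delete-x-after : ∀ p (c : Letter m n) s i → IndelStep (p ++ c ∷ x i ∷ s) (p ++ c ∷ s)
  delete-x-after p c s i =
    subst₂ IndelStep (++-assoc p (c ∷ []) (x i ∷ s)) (++-assoc p (c ∷ []) s) (del (p ++ c ∷ []) s i)

  y-insertion-cover⇒YOrEnd : ∀ p s j → LowerCover (p ++ s) (p ++ y j ∷ s) → YOrEnd s
  y-insertion-cover⇒YOrEnd p [] j _ = end
  y-insertion-cover⇒YOrEnd p (y _ ∷ _) j _ = y-next
  y-insertion-cover⇒YOrEnd p (x i ∷ s) j ((_ , sv) , (_ , su) , _ , _ , cover)
    with cover w (Shuffled⇒IsShuf sw) v≤w w≤u
    where
      w = p ++ x i ∷ y j ∷ s
      sw : Shuffled w
      sw = AllPairs-swap p su tt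
      v≤w = single-move sv sw (inj₁ (insert-y-after p (x i) s j))
      w≤u = single-move sw su (inj₂ (swap p s i j))
  ... | inj₁ w≡v = ⊥-elim (++-∷-≢ [] (sym (∷-injectiveʳ (++-cancelˡ p (x i ∷ y j ∷ s) _ w≡v))))
  ... | inj₂ w≡u with ++-cancelˡ p (x i ∷ y j ∷ s) _ w≡u
  ... | ()

  x-deletion-cover⇒XOrEnd : ∀ p s i → LowerCover (p ++ x i ∷ s) (p ++ s) → XOrEnd s
  x-deletion-cover⇒XOrEnd p [] i _ = end
  x-deletion-cover⇒XOrEnd p (x _ ∷ _) i _ = x-next
  x-deletion-cover⇒XOrEnd p (y j ∷ s) i ((_ , sv) , (_ , su) , _ , _ , cover)
    with cover w (Shuffled⇒IsShuf sw) v≤w w≤u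
    where
      w = p ++ y j ∷ x i ∷ s
      sw : Shuffled w
      sw = AllPairs-swap p sv tt
      v≤w = single-move sv sw (inj₂ (swap p s i j))
      w≤u = single-move sw su (inj₁ (delete-x-after p (y j) s i))
  ... | inj₂ w≡u = ⊥-elim (++-∷-≢ [] (sym (∷-injectiveʳ (++-cancelˡ p (y j ∷ x i ∷ s) _ w≡u))))
  ... | inj₁ w≡v with ++-cancelˡ p (y j ∷ x i ∷ s) _ w≡v
  ... | ()

-- Enumerating the lower covers

module _ {m n : ℕ} where

  Unique-map-∷ : ∀ (a : Letter m n) {L : List (Word m n)} → Unique L → Unique (map (a ∷_) L)
  Unique-map-∷ a = Uniqueₚ.map⁺ ∷-injectiveʳ

  ∉-map-∷ : ∀ {a b : Letter m n} {v : Word m n} {L} → a ≢ b → (a ∷ v) ∉ map (b ∷_) L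
  ∉-map-∷ a≢b q with map∷⁻ q
  ... | _ , _ , eq = a≢b (∷-injectiveˡ eq)

  TransStep-∷ : ∀ a {v u : Word m n} → TransStep v u → TransStep (a ∷ v) (a ∷ u)
  TransStep-∷ a (swap p s i j) = swap (a ∷ p) s i j

  transCovers : Word m n → List (Word m n)
  transCovers [] = []
  transCovers (x i ∷ s) = map (x i ∷_) (transCovers s)
  transCovers (y j ∷ []) = []
  transCovers (y j ∷ x i ∷ s) = (x i ∷ y j ∷ s) ∷ map (y j ∷_) (transCovers (x i ∷ s))
  transCovers (y j ∷ y l ∷ s) = map (y j ∷_) (transCovers (y l ∷ s))

  ∈-transCovers⁻ : ∀ u {v} → v ∈ transCovers u → TransStep v u
  ∈-transCovers⁻ (x i ∷ s) q with map∷⁻ q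
  ... | _ , q′ , refl = TransStep-∷ (x i) (∈-transCovers⁻ s q′)
  ∈-transCovers⁻ (y j ∷ x i ∷ s) (here refl) = swap [] s i j
  ∈-transCovers⁻ (y j ∷ x i ∷ s) (there q) with map∷⁻ q
  ... | _ , q′ , refl = TransStep-∷ (y j) (∈-transCovers⁻ (x i ∷ s) q′)
  ∈-transCovers⁻ (y j ∷ y l ∷ s) q with map∷⁻ q
  ... | _ , q′ , refl = TransStep-∷ (y j) (∈-transCovers⁻ (y l ∷ s) q′)

  ∈-transCovers⁺ : ∀ {v u} → TransStep v u → v ∈ transCovers u
  ∈-transCovers⁺ (swap p s i j) = go p
    where
      go : ∀ p → (p ++ x i ∷ y j ∷ s) ∈ transCovers (p ++ y j ∷ x i ∷ s)
      go [] = here refl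
      go (x k ∷ p) = ∈-map⁺ (x k ∷_) (go p)
      go (y l ∷ []) = ∈-map⁺ (y l ∷_) (here refl)
      go (y l ∷ x k ∷ p) = there (∈-map⁺ (y l ∷_) (go (x k ∷ p)))
      go (y l ∷ y k ∷ p) = ∈-map⁺ (y l ∷_) (go (y k ∷ p))

  transCovers-unique : ∀ u → Unique (transCovers u)
  transCovers-unique [] = []
  transCovers-unique (x i ∷ s) = Unique-map-∷ (x i) (transCovers-unique s)
  transCovers-unique (y j ∷ []) = []
  transCovers-unique (y j ∷ x i ∷ s) =
    ¬Any⇒All¬ _ (∉-map-∷ (λ ())) ∷ Unique-map-∷ (y j) (transCovers-unique (x i ∷ s))
  transCovers-unique (y j ∷ y l ∷ s) = Unique-map-∷ (y j) (transCovers-unique (y l ∷ s))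

  data YDeletion : Word m n → Word m n → Set where
    delete-y : ∀ p s j → YOrEnd s → YDeletion (p ++ s) (p ++ y j ∷ s)

  YDeletion-∷ : ∀ a {v u : Word m n} → YDeletion v u → YDeletion (a ∷ v) (a ∷ u)
  YDeletion-∷ a (delete-y p s j y-or-end) = delete-y (a ∷ p) s j y-or-end

  yDeletions : Word m n → List (Word m n)
  yDeletions [] = []
  yDeletions (x i ∷ s) = map (x i ∷_) (yDeletions s)
  yDeletions (y j ∷ []) = [] ∷ []
  yDeletions (y j ∷ x i ∷ s) = map (y j ∷_) (yDeletions (x i ∷ s))
  yDeletions (y j ∷ y l ∷ s) = (y l ∷ s) ∷ map (y j ∷_) (yDeletions (y l ∷ s))

  ∈-yDeletions⁻ : ∀ u {v} → v ∈ yDeletions u → YDeletion v u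
  ∈-yDeletions⁻ (x i ∷ s) q with map∷⁻ q
  ... | _ , q′ , refl = YDeletion-∷ (x i) (∈-yDeletions⁻ s q′)
  ∈-yDeletions⁻ (y j ∷ []) (here refl) = delete-y [] [] j end
  ∈-yDeletions⁻ (y j ∷ x i ∷ s) q with map∷⁻ q
  ... | _ , q′ , refl = YDeletion-∷ (y j) (∈-yDeletions⁻ (x i ∷ s) q′)
  ∈-yDeletions⁻ (y j ∷ y l ∷ s) (here refl) = delete-y [] (y l ∷ s) j y-next
  ∈-yDeletions⁻ (y j ∷ y l ∷ s) (there q) with map∷⁻ q
  ... | _ , q′ , refl = YDeletion-∷ (y j) (∈-yDeletions⁻ (y l ∷ s) q′)

  ∈-yDeletions⁺ : ∀ {v u} → YDeletion v u → v ∈ yDeletions u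
  ∈-yDeletions⁺ (delete-y p s j y-or-end) = go p y-or-end
    where
      go : ∀ p → YOrEnd s → (p ++ s) ∈ yDeletions (p ++ y j ∷ s)
      go [] end = here refl
      go [] y-next = here refl
      go (x k ∷ p) y-or-end = ∈-map⁺ (x k ∷_) (go p y-or-end)
      go (y l ∷ []) y-or-end = there (∈-map⁺ (y l ∷_) (go [] y-or-end))
      go (y l ∷ x k ∷ p) y-or-end = ∈-map⁺ (y l ∷_) (go (x k ∷ p) y-or-end)
      go (y l ∷ y k ∷ p) y-or-end = there (∈-map⁺ (y l ∷_) (go (y k ∷ p) y-or-end))

  yDeletions-unique : ∀ u → Shuffled u → Unique (yDeletions u)
  yDeletions-unique [] _ = []
  yDeletions-unique (x i ∷ s) (_ ∷ su) = Unique-map-∷ (x i) (yDeletions-unique s su)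
  yDeletions-unique (y j ∷ []) _ = [] ∷ []
  yDeletions-unique (y j ∷ x i ∷ s) (_ ∷ su) = Unique-map-∷ (y j) (yDeletions-unique (x i ∷ s) su)
  yDeletions-unique (y j ∷ y l ∷ s) ((j<l ∷ _) ∷ su) =
    ¬Any⇒All¬ _ (∉-map-∷ (λ eq → Before⇒≢ j<l (sym eq))) ∷ Unique-map-∷ (y j) (yDeletions-unique (y l ∷ s) su)

  data XInsertion (i : Fin m) : Word m n → Word m n → Set where
    insert-x : ∀ p s → XOrEnd s → XInsertion i (p ++ x i ∷ s) (p ++ s)

  XInsertion-∷ : ∀ {i} a {v u : Word m n} → XInsertion i v u → XInsertion i (a ∷ v) (a ∷ u)
  XInsertion-∷ a (insert-x p s x-or-end) = insert-x (a ∷ p) s x-or-end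

  ∈-XInsertion⁻ : ∀ {i v u c} → XInsertion i v u → c ∈ v → c ≡ x i ⊎ c ∈ u
  ∈-XInsertion⁻ (insert-x p s _) = ∈-insert⁻ p

  insertX : Fin m → Word m n → Word m n
  insertX i [] = x i ∷ []
  insertX i (x k ∷ s) with i <? k
  ... | yes _ = x i ∷ x k ∷ s
  ... | no _ = x k ∷ insertX i s
  insertX i (y j ∷ s) = y j ∷ insertX i s

  insertX-XInsertion : ∀ i u → XInsertion i (insertX i u) u
  insertX-XInsertion i [] = insert-x [] [] end
  insertX-XInsertion i (x k ∷ s) with i <? k
  ... | yes _ = insert-x [] (x k ∷ s) x-next
  ... | no _ = XInsertion-∷ (x k) (insertX-XInsertion i s)
  insertX-XInsertion i (y j ∷ s) = XInsertion-∷ (y j) (insertX-XInsertion i s)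

  x∈XInsertion : ∀ {i v u} → XInsertion i v u → x i ∈ v
  x∈XInsertion (insert-x p _ _) = ∈-insert p

  All-insertX : ∀ {P : Letter m n → Set} i u → P (x i) → All P u → All P (insertX i u)
  All-insertX i u pi all = All.tabulate λ q → case ∈-XInsertion⁻ (insertX-XInsertion i u) q of λ
    { (inj₁ refl) → pi ; (inj₂ r) → All.lookup all r }

  insertX-shuffled : ∀ i u → Shuffled u → x i ∉ u → Shuffled (insertX i u)
  insertX-shuffled i [] _ _ = [] ∷ []
  insertX-shuffled i (x k ∷ s) (k< ∷ su) xi∉ with i <? k
  ... | yes i<k = (i<k ∷ All.map (λ {c} → i<k⇒ {c}) k<) ∷ k< ∷ su
    where
      i<k⇒ : ∀ {c} → Before (x k) c → Before (x i) c
      i<k⇒ {x _} k<l = <-trans i<k k<l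
      i<k⇒ {y _} _ = tt
  ... | no i≮k = All-insertX i s k<i k< ∷ insertX-shuffled i s su (λ q → xi∉ (there q))
    where
      k<i : Before {m} {n} (x k) (x i)
      k<i with <-cmp k i
      ... | tri< k<i _ _ = k<i
      ... | tri≈ _ refl _ = ⊥-elim (xi∉ (here refl))
      ... | tri> _ _ i<k = ⊥-elim (i≮k i<k)
  insertX-shuffled i (y j ∷ s) (j< ∷ su) xi∉ =
    All-insertX i s tt j< ∷ insertX-shuffled i s su (λ q → xi∉ (there q))

  insertX-canonical : ∀ i p s → Shuffled (p ++ x i ∷ s) → XOrEnd s → insertX i (p ++ s) ≡ p ++ x i ∷ s
  insertX-canonical i [] [] _ _ = refl
  insertX-canonical i [] (x k ∷ s) ((i<k ∷ _) ∷ _) _ with i <? k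
  ... | yes _ = refl
  ... | no i≮k = ⊥-elim (i≮k i<k)
  insertX-canonical i (x k ∷ p) s (k< ∷ su) x-or-end with i <? k
  ... | yes i<k = ⊥-elim (<-asym i<k (All.lookup k< (∈-insert p)))
  ... | no _ = cong (x k ∷_) (insertX-canonical i p s su x-or-end)
  insertX-canonical i (y j ∷ p) s (_ ∷ su) x-or-end = cong (y j ∷_) (insertX-canonical i p s su x-or-end)

  absent? : ∀ (u : Word m n) i → Dec (x i ∉ u)
  absent? u i = ¬? (∈-dec _≟ₗ_ (x i) u)

  absentX : Word m n → List (Fin m)
  absentX u = filter (absent? u) (allFin m)

  xInsertions : Word m n → List (Word m n)
  xInsertions u = map (λ i → insertX i u) (absentX u)

  ∈-xInsertions⁻ : ∀ u {v} → Shuffled u → v ∈ xInsertions u → Σ (Fin m) λ i → XInsertion i v u × Shuffled v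
  ∈-xInsertions⁻ u su q with ∈-map⁻ (λ i → insertX i u) q
  ... | i , i∈ , refl =
      i , insertX-XInsertion i u , insertX-shuffled i u su (proj₂ (∈-filter⁻ (absent? u) {xs = allFin m} i∈))

  ∈-xInsertions⁺ : ∀ i p s → Shuffled (p ++ x i ∷ s) → XOrEnd s → (p ++ x i ∷ s) ∈ xInsertions (p ++ s)
  ∈-xInsertions⁺ i p s sv x-or-end = subst (_∈ xInsertions (p ++ s)) (insertX-canonical i p s sv x-or-end)
    (∈-map⁺ (λ k → insertX k (p ++ s))
      (∈-filter⁺ (absent? (p ++ s)) (∈-allFin i) (Unique-insert⇒∉ p (Shuffled⇒Unique sv))))

  xInsertions-unique : ∀ u → Unique (xInsertions u)
  xInsertions-unique u = Unique-map-injectiveOn (λ i → insertX i u) injective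
    (Uniqueₚ.filter⁺ (absent? u) (Uniqueₚ.allFin⁺ m))
    where
      injective : ∀ {i k} → i ∈ absentX u → k ∈ absentX u → i ≢ k → insertX i u ≢ insertX k u
      injective {i} i∈ _ i≢k eq with ∈-XInsertion⁻ (insertX-XInsertion _ u)
        (subst (x i ∈_) eq (x∈XInsertion (insertX-XInsertion i u)))
      ... | inj₁ xi≡xk = i≢k (x-injective xi≡xk)
      ... | inj₂ xi∈u = proj₂ (∈-filter⁻ (absent? u) {xs = allFin m} i∈) xi∈u

  indelCovers : Word m n → List (Word m n)
  indelCovers u = yDeletions u ++ xInsertions u

  indelCovers-unique : ∀ u → Shuffled u → Unique (indelCovers u)
  indelCovers-unique u su = Uniqueₚ.++⁺ (yDeletions-unique u su) (xInsertions-unique u) disjoint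
    where
      shorter : ∀ {v} → YDeletion v u → length u ≡ suc (length v)
      shorter (delete-y p s j _) = length-++-sucʳ p (y j) s
      longer : ∀ {i v} → XInsertion i v u → length v ≡ suc (length u)
      longer (insert-x p s _) = length-++-sucʳ p (x _) s
      disjoint : ∀ {v} → ¬ (v ∈ yDeletions u × v ∈ xInsertions u)
      disjoint (v∈dels , v∈inss) with ∈-xInsertions⁻ u su v∈inss
      ... | _ , insertion , _ =
          m≢1+n+m (length u) {1} (trans (shorter (∈-yDeletions⁻ u v∈dels)) (cong suc (longer insertion)))

  TransStep⇒cover : ∀ {v u : Word m n} → Shuffled u → TransStep v u → LowerCover v u × TransStep v u
  TransStep⇒cover su (swap p s i j) = swap-cover p s i j su , swap p s i j

  YDeletion⇒cover : ∀ {v u : Word m n} → Shuffled u → YDeletion v u → LowerCover v u × IndelStep v u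
  YDeletion⇒cover su (delete-y p s j y-or-end) = y-insertion-cover p s j y-or-end su , ins p s j

  XInsertion⇒cover : ∀ {i} {v u : Word m n} → Shuffled v → XInsertion i v u → LowerCover v u × IndelStep v u
  XInsertion⇒cover sv (insert-x p s x-or-end) = x-deletion-cover p s _ x-or-end sv , del p s _

  TransLowerCovers↔Fin : ∀ u → Shuffled u → TransLowerCovers u ↔ Fin (length (transCovers u))
  TransLowerCovers↔Fin u su = Subtype-Fin-length (≡-dec _≟ₗ_) (transCovers u) (transCovers-unique u)
    (λ q → TransStep⇒cover su (∈-transCovers⁻ u q)) (λ (_ , step) → ∈-transCovers⁺ step)

  IndelLowerCovers↔Fin : ∀ u → Shuffled u → IndelLowerCovers u ↔ Fin (length (indelCovers u))
  IndelLowerCovers↔Fin u su =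
    Subtype-Fin-length (≡-dec _≟ₗ_) (indelCovers u) (indelCovers-unique u su) sound complete
    where
      sound : ∀ {v} → v ∈ indelCovers u → LowerCover v u × IndelStep v u
      sound q with ∈-++⁻ (yDeletions u) q
      ... | inj₁ v∈dels = YDeletion⇒cover su (∈-yDeletions⁻ u v∈dels)
      ... | inj₂ v∈inss with ∈-xInsertions⁻ u su v∈inss
      ...   | _ , insertion , sv = XInsertion⇒cover sv insertion
      complete : ∀ {v} → LowerCover v u × IndelStep v u → v ∈ indelCovers u
      complete (cover , ins p s j) =
        ∈-++⁺ˡ (∈-yDeletions⁺ (delete-y p s j (y-insertion-cover⇒YOrEnd p s j cover)))
      complete (cover , del p s i) =
        ∈-++⁺ʳ (yDeletions u)
        (∈-xInsertions⁺ i p s (proj₂ (proj₁ cover)) (x-deletion-cover⇒XOrEnd p s i cover))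

-- Tagging the letters of a shuffle word

-- An x is matched when it directly follows a y, a y when an x directly follows it.
data Tag : Set where
  matched unmatched absent : Tag

_≟ᵗ_ : DecidableEquality Tag
matched ≟ᵗ matched = yes refl
matched ≟ᵗ unmatched = no (λ ())
matched ≟ᵗ absent = no (λ ())
unmatched ≟ᵗ matched = no (λ ())
unmatched ≟ᵗ unmatched = yes refl
unmatched ≟ᵗ absent = no (λ ())
absent ≟ᵗ matched = no (λ ())
absent ≟ᵗ unmatched = no (λ ())
absent ≟ᵗ absent = yes refl

Tagged : ℕ → Set
Tagged k = List (Fin k × Tag)

fsts : ∀ {A : Set} → List (A × Tag) → List A
fsts = map proj₁

module _ {A : Set} where

  absents : List A → List (A × Tag)
  absents = map (_, absent)

  count : Tag → List (A × Tag) → ℕ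
  count t [] = 0
  count t ((_ , t′) ∷ l) with t ≟ᵗ t′
  ... | yes _ = suc (count t l)
  ... | no _ = count t l

  count-absents-++ : ∀ t → t ≢ absent → ∀ pre l → count t (absents pre ++ l) ≡ count t l
  count-absents-++ t t≢absent [] l = refl
  count-absents-++ t t≢absent (_ ∷ pre) l with t ≟ᵗ absent
  ... | yes t≡absent = ⊥-elim (t≢absent t≡absent)
  ... | no _ = count-absents-++ t t≢absent pre l

  count-absent-absents-++ : ∀ pre l → count absent (absents pre ++ l) ≡ length pre + count absent l
  count-absent-absents-++ [] l = refl
  count-absent-absents-++ (_ ∷ pre) l = cong suc (count-absent-absents-++ pre l)

  fsts-absents : ∀ (is : List A) → fsts (absents is) ≡ is
  fsts-absents [] = refl
  fsts-absents (i ∷ is) = cong (i ∷_) (fsts-absents is)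

  fsts-absents-++ : ∀ (pre : List A) l → fsts (absents pre ++ l) ≡ pre ++ fsts l
  fsts-absents-++ [] l = refl
  fsts-absents-++ (i ∷ pre) l = cong (i ∷_) (fsts-absents-++ pre l)

  count-absents : ∀ t → t ≢ absent → (is : List A) → count t (absents is) ≡ 0
  count-absents t t≢absent [] = refl
  count-absents t t≢absent (_ ∷ is) with t ≟ᵗ absent
  ... | yes t≡absent = ⊥-elim (t≢absent t≡absent)
  ... | no _ = count-absents t t≢absent is

  count-absent-absents : ∀ (is : List A) → count absent (absents is) ≡ length is
  count-absent-absents [] = refl
  count-absent-absents (_ ∷ is) = cong suc (count-absent-absents is)

module _ {m n : ℕ} where

  xTag : Bool → Tag
  xTag true = matched
  xTag false = unmatched

  yTag : Word m n → Tag
  yTag (x _ ∷ _) = matched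
  yTag _ = unmatched

  -- is lists the indices not yet tagged; the flag records whether the previous letter was a y.
  tagsX : List (Fin m) → Bool → Word m n → Tagged m
  tagsX is _ [] = absents is
  tagsX is afterY (x k ∷ w) =
    let (pre , post) = cut _≟ᶠ_ k is in absents pre ++ (k , xTag afterY) ∷ tagsX post false w
  tagsX is _ (y _ ∷ w) = tagsX is true w

  tagsY : List (Fin n) → Word m n → Tagged n
  tagsY js [] = absents js
  tagsY js (x _ ∷ w) = tagsY js w
  tagsY js (y l ∷ w) = let (pre , post) = cut _≟ᶠ_ l js in absents pre ++ (l , yTag w) ∷ tagsY post w

  tags : List (Fin m) → List (Fin n) → Word m n → Tagged m × Tagged n
  tags is js w = tagsX is false w , tagsY js w

  encode : Word m n → Tagged m × Tagged n
  encode = tags (allFin m) (allFin n)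

  mutual
    decode : Tagged m → Tagged n → Word m n
    decode [] ys = decodeYs ys
    decode ((i , matched) ∷ xs) ys = decodeUpTo i xs ys
    decode ((i , unmatched) ∷ xs) ys = x i ∷ decode xs ys
    decode ((_ , absent) ∷ xs) ys = decode xs ys

    -- x i is matched: the unmatched y's come first, then the matched y directly followed by x i
    decodeUpTo : Fin m → Tagged m → Tagged n → Word m n
    decodeUpTo i xs [] = []
    decodeUpTo i xs ((j , matched) ∷ ys) = y j ∷ x i ∷ decode xs ys
    decodeUpTo i xs ((j , unmatched) ∷ ys) = y j ∷ decodeUpTo i xs ys
    decodeUpTo i xs ((_ , absent) ∷ ys) = decodeUpTo i xs ys

    decodeYs : Tagged n → Word m n
    decodeYs [] = []
    decodeYs ((_ , matched) ∷ ys) = decodeYs ys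
    decodeYs ((j , unmatched) ∷ ys) = y j ∷ decodeYs ys
    decodeYs ((_ , absent) ∷ ys) = decodeYs ys

  decode-absents : ∀ pre xs ys → decode (absents pre ++ xs) ys ≡ decode xs ys
  decode-absents [] xs ys = refl
  decode-absents (_ ∷ pre) xs ys = decode-absents pre xs ys

  decodeUpTo-absents : ∀ i xs pre ys → decodeUpTo i xs (absents pre ++ ys) ≡ decodeUpTo i xs ys
  decodeUpTo-absents i xs [] ys = refl
  decodeUpTo-absents i xs (_ ∷ pre) ys = decodeUpTo-absents i xs pre ys

  decodeYs-absents : ∀ pre ys → decodeYs (absents pre ++ ys) ≡ decodeYs ys
  decodeYs-absents [] ys = refl
  decodeYs-absents (_ ∷ pre) ys = decodeYs-absents pre ys

  data ReadyForY : Tagged m → Set where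
    done : ReadyForY []
    skip-absent : ∀ {i xs} → ReadyForY xs → ReadyForY ((i , absent) ∷ xs)
    next-matched : ∀ {i xs} → ReadyForY ((i , matched) ∷ xs)

  ReadyForY-absents : ∀ pre {xs} → ReadyForY xs → ReadyForY (absents pre ++ xs)
  ReadyForY-absents [] ready = ready
  ReadyForY-absents (_ ∷ pre) ready = skip-absent (ReadyForY-absents pre ready)

  tagsX-ready : ∀ is w → ReadyForY (tagsX is true w)
  tagsX-ready [] [] = done
  tagsX-ready (_ ∷ is) [] = skip-absent (tagsX-ready is [])
  tagsX-ready is (x k ∷ w) = ReadyForY-absents (proj₁ (cut _≟ᶠ_ k is)) next-matched
  tagsX-ready is (y _ ∷ w) = tagsX-ready is w

  decode-ready : ∀ {xs} → ReadyForY xs → ∀ pre l ys →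
    decode xs (absents pre ++ (l , unmatched) ∷ ys) ≡ y l ∷ decode xs ys
  decode-ready done pre l ys = decodeYs-absents pre ((l , unmatched) ∷ ys)
  decode-ready (skip-absent ready) pre l ys = decode-ready ready pre l ys
  decode-ready (next-matched {i} {xs}) pre l ys = decodeUpTo-absents i xs pre ((l , unmatched) ∷ ys)

  xIndices : Word m n → List (Fin m)
  xIndices [] = []
  xIndices (x k ∷ w) = k ∷ xIndices w
  xIndices (y _ ∷ w) = xIndices w

  yIndices : Word m n → List (Fin n)
  yIndices [] = []
  yIndices (x _ ∷ w) = yIndices w
  yIndices (y l ∷ w) = l ∷ yIndices w

  decode-tags : ∀ w is js → xIndices w ⊆ is → yIndices w ⊆ js → decode (tagsX is false w) (tagsY js w) ≡ w
  decode-tags [] is js _ _ = nothing-present is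
    where
      nothing-present : ∀ is → decode (absents is) (absents js) ≡ []
      nothing-present [] = no-ys js
        where
          no-ys : ∀ js → decodeYs (absents js) ≡ []
          no-ys [] = refl
          no-ys (_ ∷ js) = no-ys js
      nothing-present (_ ∷ is) = nothing-present is
  decode-tags (x k ∷ w) is js xs⊆ ys⊆ =
    trans (decode-absents (proj₁ (cut _≟ᶠ_ k is)) _ _)
      (cong (x k ∷_) (decode-tags w _ js (cut-⊆-rest _≟ᶠ_ is xs⊆) ys⊆))
  decode-tags (y l ∷ []) is js xs⊆ ys⊆ =
    trans (decode-ready (tagsX-ready is []) _ l _)
      (cong (y l ∷_) (decode-tags [] is _ xs⊆ (cut-⊆-rest _≟ᶠ_ js ys⊆)))
  decode-tags (y l ∷ y l′ ∷ w) is js xs⊆ ys⊆ =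
    trans (decode-ready (tagsX-ready is (y l′ ∷ w)) _ l _)
      (cong (y l ∷_) (decode-tags (y l′ ∷ w) is _ xs⊆ (cut-⊆-rest _≟ᶠ_ js ys⊆)))
  decode-tags (y l ∷ x k ∷ w) is js xs⊆ ys⊆ =
    trans (decode-absents (proj₁ (cut _≟ᶠ_ k is)) _ _)
      (trans (decodeUpTo-absents k _ (proj₁ (cut _≟ᶠ_ l js)) _)
        (cong (λ w′ → y l ∷ x k ∷ w′) (decode-tags w _ _ (cut-⊆-rest _≟ᶠ_ is xs⊆) (cut-⊆-rest _≟ᶠ_ js ys⊆))))

  ∈-xIndices⁻ : ∀ w {i} → i ∈ xIndices w → x i ∈ w
  ∈-xIndices⁻ (x k ∷ w) (here refl) = here refl
  ∈-xIndices⁻ (x k ∷ w) (there q) = there (∈-xIndices⁻ w q)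
  ∈-xIndices⁻ (y l ∷ w) q = there (∈-xIndices⁻ w q)

  ∈-xIndices⁺ : ∀ w {i} → x i ∈ w → i ∈ xIndices w
  ∈-xIndices⁺ (x k ∷ w) (here refl) = here refl
  ∈-xIndices⁺ (x k ∷ w) (there q) = there (∈-xIndices⁺ w q)
  ∈-xIndices⁺ (y l ∷ w) (there q) = ∈-xIndices⁺ w q

  ∈-yIndices⁻ : ∀ w {j} → j ∈ yIndices w → y j ∈ w
  ∈-yIndices⁻ (y l ∷ w) (here refl) = here refl
  ∈-yIndices⁻ (y l ∷ w) (there q) = there (∈-yIndices⁻ w q)
  ∈-yIndices⁻ (x k ∷ w) q = there (∈-yIndices⁻ w q)

  xIndices-sorted : ∀ w → Shuffled w → Sorted (xIndices w)
  xIndices-sorted [] _ = []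
  xIndices-sorted (x k ∷ w) (k< ∷ sw) =
    All.tabulate (λ q → All.lookup k< (∈-xIndices⁻ w q)) ∷ xIndices-sorted w sw
  xIndices-sorted (y l ∷ w) (_ ∷ sw) = xIndices-sorted w sw

  yIndices-sorted : ∀ w → Shuffled w → Sorted (yIndices w)
  yIndices-sorted [] _ = []
  yIndices-sorted (y l ∷ w) (l< ∷ sw) =
    All.tabulate (λ q → All.lookup l< (∈-yIndices⁻ w q)) ∷ yIndices-sorted w sw
  yIndices-sorted (x k ∷ w) (_ ∷ sw) = yIndices-sorted w sw

  xIndices-⊆-allFin : ∀ w → Shuffled w → xIndices w ⊆ allFin m
  xIndices-⊆-allFin w sw = sorted-⊆ (xIndices-sorted w sw) (allFin-sorted m) (λ {i} _ → ∈-allFin i)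

  yIndices-⊆-allFin : ∀ w → Shuffled w → yIndices w ⊆ allFin n
  yIndices-⊆-allFin w sw = sorted-⊆ (yIndices-sorted w sw) (allFin-sorted n) (λ {j} _ → ∈-allFin j)

  mutual
    ∈x-decode : ∀ xs ys {k} → x k ∈ decode xs ys → k ∈ fsts xs
    ∈x-decode [] ys q = ⊥-elim (∉x-decodeYs ys q)
    ∈x-decode ((i , matched) ∷ xs) ys q = ∈x-decodeUpTo i xs ys q
    ∈x-decode ((i , unmatched) ∷ xs) ys (here refl) = here refl
    ∈x-decode ((i , unmatched) ∷ xs) ys (there q) = there (∈x-decode xs ys q)
    ∈x-decode ((i , absent) ∷ xs) ys q = there (∈x-decode xs ys q)

    ∈x-decodeUpTo : ∀ i xs ys {k} → x k ∈ decodeUpTo i xs ys → k ∈ i ∷ fsts xs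
    ∈x-decodeUpTo i xs ((j , matched) ∷ ys) (there (here refl)) = here refl
    ∈x-decodeUpTo i xs ((j , matched) ∷ ys) (there (there q)) = there (∈x-decode xs ys q)
    ∈x-decodeUpTo i xs ((j , unmatched) ∷ ys) (there q) = ∈x-decodeUpTo i xs ys q
    ∈x-decodeUpTo i xs ((j , absent) ∷ ys) q = ∈x-decodeUpTo i xs ys q

    ∉x-decodeYs : ∀ ys {k} → x k ∉ decodeYs ys
    ∉x-decodeYs ((j , matched) ∷ ys) q = ∉x-decodeYs ys q
    ∉x-decodeYs ((j , unmatched) ∷ ys) (there q) = ∉x-decodeYs ys q
    ∉x-decodeYs ((j , absent) ∷ ys) q = ∉x-decodeYs ys q

  mutual
    ∈y-decode : ∀ xs ys {l} → y l ∈ decode xs ys → l ∈ fsts ys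
    ∈y-decode [] ys q = ∈y-decodeYs ys q
    ∈y-decode ((i , matched) ∷ xs) ys q = ∈y-decodeUpTo i xs ys q
    ∈y-decode ((i , unmatched) ∷ xs) ys (there q) = ∈y-decode xs ys q
    ∈y-decode ((i , absent) ∷ xs) ys q = ∈y-decode xs ys q

    ∈y-decodeUpTo : ∀ i xs ys {l} → y l ∈ decodeUpTo i xs ys → l ∈ fsts ys
    ∈y-decodeUpTo i xs ((j , matched) ∷ ys) (here refl) = here refl
    ∈y-decodeUpTo i xs ((j , matched) ∷ ys) (there (there q)) = there (∈y-decode xs ys q)
    ∈y-decodeUpTo i xs ((j , unmatched) ∷ ys) (here refl) = here refl
    ∈y-decodeUpTo i xs ((j , unmatched) ∷ ys) (there q) = there (∈y-decodeUpTo i xs ys q)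
    ∈y-decodeUpTo i xs ((j , absent) ∷ ys) q = there (∈y-decodeUpTo i xs ys q)

    ∈y-decodeYs : ∀ ys {l} → y l ∈ decodeYs ys → l ∈ fsts ys
    ∈y-decodeYs ((j , matched) ∷ ys) q = there (∈y-decodeYs ys q)
    ∈y-decodeYs ((j , unmatched) ∷ ys) (here refl) = here refl
    ∈y-decodeYs ((j , unmatched) ∷ ys) (there q) = there (∈y-decodeYs ys q)
    ∈y-decodeYs ((j , absent) ∷ ys) q = there (∈y-decodeYs ys q)

  x-Before-all : ∀ {i : Fin m} {is} {w : Word m n} → All (i <ᶠ_) is → (∀ {k} → x k ∈ w → k ∈ is) → ∀ {c} →
    c ∈ w → Before (x i) c
  x-Before-all i< indices {x _} q = All.lookup i< (indices q)
  x-Before-all i< indices {y _} q = tt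

  y-Before-all : ∀ {j : Fin n} {js} {w : Word m n} → All (j <ᶠ_) js → (∀ {l} → y l ∈ w → l ∈ js) → ∀ {c} →
    c ∈ w → Before (y j) c
  y-Before-all j< indices {x _} q = tt
  y-Before-all j< indices {y _} q = All.lookup j< (indices q)

  mutual
    decode-shuffled : ∀ xs ys → Sorted (fsts xs) → Sorted (fsts ys) → Shuffled (decode xs ys)
    decode-shuffled [] ys _ sy = decodeYs-shuffled ys sy
    decode-shuffled ((i , matched) ∷ xs) ys (i< ∷ sx) sy = decodeUpTo-shuffled i xs ys i< sx sy
    decode-shuffled ((i , unmatched) ∷ xs) ys (i< ∷ sx) sy =
      All.tabulate (x-Before-all i< (∈x-decode xs ys)) ∷ decode-shuffled xs ys sx sy
    decode-shuffled ((i , absent) ∷ xs) ys (_ ∷ sx) sy = decode-shuffled xs ys sx sy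

    decodeUpTo-shuffled : ∀ i xs ys → All (i <ᶠ_) (fsts xs) → Sorted (fsts xs) → Sorted (fsts ys) →
      Shuffled (decodeUpTo i xs ys)
    decodeUpTo-shuffled i xs [] _ _ _ = []
    decodeUpTo-shuffled i xs ((j , matched) ∷ ys) i< sx (j< ∷ sy) =
      (tt ∷ All.tabulate (y-Before-all j< (∈y-decode xs ys))) ∷ All.tabulate
        (x-Before-all i< (∈x-decode xs ys)) ∷ decode-shuffled xs ys sx sy
    decodeUpTo-shuffled i xs ((j , unmatched) ∷ ys) i< sx (j< ∷ sy) =
      All.tabulate (y-Before-all j< (∈y-decodeUpTo i xs ys)) ∷ decodeUpTo-shuffled i xs ys i< sx sy
    decodeUpTo-shuffled i xs ((j , absent) ∷ ys) i< sx (_ ∷ sy) = decodeUpTo-shuffled i xs ys i< sx sy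

    decodeYs-shuffled : ∀ ys → Sorted (fsts ys) → Shuffled (decodeYs ys)
    decodeYs-shuffled [] _ = []
    decodeYs-shuffled ((j , matched) ∷ ys) (_ ∷ sy) = decodeYs-shuffled ys sy
    decodeYs-shuffled ((j , unmatched) ∷ ys) (j< ∷ sy) =
      All.tabulate (y-Before-all j< (∈y-decodeYs ys)) ∷ decodeYs-shuffled ys sy
    decodeYs-shuffled ((j , absent) ∷ ys) (_ ∷ sy) = decodeYs-shuffled ys sy

  tagsX-absent : ∀ i is afterY w → x i ∉ w → tagsX (i ∷ is) afterY w ≡ (i , absent) ∷ tagsX is afterY w
  tagsX-absent i is afterY [] _ = refl
  tagsX-absent i is afterY (x k ∷ w) xi∉ rewrite cut-other _≟ᶠ_ k i is (λ { refl → xi∉ (here refl) }) = refl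
  tagsX-absent i is afterY (y _ ∷ w) xi∉ = tagsX-absent i is true w (λ q → xi∉ (there q))

  tagsY-absent : ∀ j js w → y j ∉ w → tagsY (j ∷ js) w ≡ (j , absent) ∷ tagsY js w
  tagsY-absent j js [] _ = refl
  tagsY-absent j js (x _ ∷ w) yj∉ = tagsY-absent j js w (λ q → yj∉ (there q))
  tagsY-absent j js (y l ∷ w) yj∉ rewrite cut-other _≟ᶠ_ l j js (λ { refl → yj∉ (here refl) }) = refl

  tagsX-YOrEnd : ∀ is {w} → YOrEnd w → tagsX is true w ≡ tagsX is false w
  tagsX-YOrEnd is end = refl
  tagsX-YOrEnd is y-next = refl

  yTag-YOrEnd : ∀ {w} → YOrEnd w → yTag w ≡ unmatched
  yTag-YOrEnd end = refl
  yTag-YOrEnd y-next = refl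

  decodeUpTo-YOrEnd : ∀ i xs ys → YOrEnd (decodeUpTo i xs ys)
  decodeUpTo-YOrEnd i xs [] = end
  decodeUpTo-YOrEnd i xs ((_ , matched) ∷ ys) = y-next
  decodeUpTo-YOrEnd i xs ((_ , unmatched) ∷ ys) = y-next
  decodeUpTo-YOrEnd i xs ((_ , absent) ∷ ys) = decodeUpTo-YOrEnd i xs ys

  decodeYs-YOrEnd : ∀ ys → YOrEnd (decodeYs ys)
  decodeYs-YOrEnd [] = end
  decodeYs-YOrEnd ((_ , matched) ∷ ys) = decodeYs-YOrEnd ys
  decodeYs-YOrEnd ((_ , unmatched) ∷ ys) = y-next
  decodeYs-YOrEnd ((_ , absent) ∷ ys) = decodeYs-YOrEnd ys

  mutual
    tags-decode : ∀ xs ys → Sorted (fsts xs) → Sorted (fsts ys) → count matched xs ≡ count matched ys →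
      tags (fsts xs) (fsts ys) (decode xs ys) ≡ (xs , ys)
    tags-decode [] ys _ sy c = tags-decodeYs ys sy (sym c)
    tags-decode ((i , matched) ∷ xs) ys (i< ∷ sx) sy c = tags-decodeUpTo i xs ys i< sx sy c
    tags-decode ((i , unmatched) ∷ xs) ys (_ ∷ sx) sy c rewrite cut-self _≟ᶠ_ i (fsts xs) =
      cong (λ (txs , tys) → (i , unmatched) ∷ txs , tys) (tags-decode xs ys sx sy c)
    tags-decode ((i , absent) ∷ xs) ys (i< ∷ sx) sy c
      rewrite tagsX-absent i (fsts xs) false (decode xs ys) (λ q → <⇒∉ i< (∈x-decode xs ys q)) =
      cong (λ (txs , tys) → (i , absent) ∷ txs , tys) (tags-decode xs ys sx sy c)

    tags-decodeUpTo : ∀ i xs ys → All (i <ᶠ_) (fsts xs) → Sorted (fsts xs) → Sorted (fsts ys) →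
      suc (count matched xs) ≡ count matched ys →
        tags (i ∷ fsts xs) (fsts ys) (decodeUpTo i xs ys) ≡ ((i , matched) ∷ xs , ys)
    tags-decodeUpTo i xs [] _ _ _ ()
    tags-decodeUpTo i xs ((j , matched) ∷ ys) i< sx (_ ∷ sy) c
      rewrite cut-self _≟ᶠ_ j (fsts ys) | cut-self _≟ᶠ_ i (fsts xs) =
      cong (λ (txs , tys) → (i , matched) ∷ txs , (j , matched) ∷ tys)
        (tags-decode xs ys sx sy (suc-injective c))
    tags-decodeUpTo i xs ((j , unmatched) ∷ ys) i< sx (_ ∷ sy) c
      rewrite cut-self _≟ᶠ_ j (fsts ys) | tagsX-YOrEnd (i ∷ fsts xs) (decodeUpTo-YOrEnd i xs ys)
            | yTag-YOrEnd (decodeUpTo-YOrEnd i xs ys) =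
      cong (λ (txs , tys) → txs , (j , unmatched) ∷ tys) (tags-decodeUpTo i xs ys i< sx sy c)
    tags-decodeUpTo i xs ((j , absent) ∷ ys) i< sx (j< ∷ sy) c
      rewrite tagsY-absent j (fsts ys) (decodeUpTo i xs ys) (λ q → <⇒∉ j< (∈y-decodeUpTo i xs ys q)) =
      cong (λ (txs , tys) → txs , (j , absent) ∷ tys) (tags-decodeUpTo i xs ys i< sx sy c)

    tags-decodeYs : ∀ ys → Sorted (fsts ys) → count matched ys ≡ 0 →
      tags [] (fsts ys) (decodeYs ys) ≡ ([] , ys)
    tags-decodeYs [] _ _ = refl
    tags-decodeYs ((j , matched) ∷ ys) _ ()
    tags-decodeYs ((j , unmatched) ∷ ys) (_ ∷ sy) c
      rewrite cut-self _≟ᶠ_ j (fsts ys) | tagsX-YOrEnd [] (decodeYs-YOrEnd ys) | yTag-YOrEnd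
        (decodeYs-YOrEnd ys) =
      cong (λ (txs , tys) → txs , (j , unmatched) ∷ tys) (tags-decodeYs ys sy c)
    tags-decodeYs ((j , absent) ∷ ys) (j< ∷ sy) c
      rewrite tagsY-absent j (fsts ys) (decodeYs ys) (λ q → <⇒∉ j< (∈y-decodeYs ys q)) =
      cong (λ (txs , tys) → txs , (j , absent) ∷ tys) (tags-decodeYs ys sy c)

  fsts-tagsX : ∀ w is afterY → xIndices w ⊆ is → fsts (tagsX is afterY w) ≡ is
  fsts-tagsX [] is _ _ = fsts-absents is
  fsts-tagsX (x k ∷ w) is _ sub = trans (fsts-absents-++ pre _)
    (trans (cong (λ rest → pre ++ k ∷ rest) (fsts-tagsX w post false (cut-⊆-rest _≟ᶠ_ is sub)))
      (sym (proj₁ (cut-⊆ _≟ᶠ_ is sub))))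
    where
      pre = proj₁ (cut _≟ᶠ_ k is)
      post = proj₂ (cut _≟ᶠ_ k is)
  fsts-tagsX (y _ ∷ w) is _ sub = fsts-tagsX w is true sub

  fsts-tagsY : ∀ w js → yIndices w ⊆ js → fsts (tagsY js w) ≡ js
  fsts-tagsY [] js _ = fsts-absents js
  fsts-tagsY (x _ ∷ w) js sub = fsts-tagsY w js sub
  fsts-tagsY (y l ∷ w) js sub = trans (fsts-absents-++ pre _)
    (trans (cong (λ rest → pre ++ l ∷ rest) (fsts-tagsY w post (cut-⊆-rest _≟ᶠ_ js sub)))
      (sym (proj₁ (cut-⊆ _≟ᶠ_ js sub))))
    where
      pre = proj₁ (cut _≟ᶠ_ l js)
      post = proj₂ (cut _≟ᶠ_ l js)

  mutual
    count-matched-tagsX : ∀ is w → count matched (tagsX is false w) ≡ length (transCovers w)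
    count-matched-tagsX is [] = count-absents matched (λ ()) is
    count-matched-tagsX is (x k ∷ w) = trans (count-absents-++ matched (λ ()) (proj₁ (cut _≟ᶠ_ k is)) _)
      (trans (count-matched-tagsX _ w) (sym (length-map (x k ∷_) (transCovers w))))
    count-matched-tagsX is (y l ∷ w) = count-matched-tagsX-afterY is l w

    count-matched-tagsX-afterY : ∀ is l w → count matched (tagsX is true w) ≡ length (transCovers (y l ∷ w))
    count-matched-tagsX-afterY is l [] = count-absents matched (λ ()) is
    count-matched-tagsX-afterY is l (x k ∷ w) =
      trans (count-absents-++ matched (λ ()) (proj₁ (cut _≟ᶠ_ k is)) _)
      (cong suc (trans (count-matched-tagsX _ w)
        (sym (trans (length-map (y l ∷_) (transCovers (x k ∷ w))) (length-map (x k ∷_) (transCovers w))))))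
    count-matched-tagsX-afterY is l (y l′ ∷ w) =
      trans (count-matched-tagsX-afterY is l′ w) (sym (length-map (y l ∷_) (transCovers (y l′ ∷ w))))

  count-matched-tagsY : ∀ js w → count matched (tagsY js w) ≡ length (transCovers w)
  count-matched-tagsY js [] = count-absents matched (λ ()) js
  count-matched-tagsY js (x k ∷ w) =
    trans (count-matched-tagsY js w) (sym (length-map (x k ∷_) (transCovers w)))
  count-matched-tagsY js (y l ∷ w) =
    trans (count-absents-++ matched (λ ()) (proj₁ (cut _≟ᶠ_ l js)) _) (next w)
    where
      post = proj₂ (cut _≟ᶠ_ l js)
      next : ∀ w → count matched ((l , yTag w) ∷ tagsY post w) ≡ length (transCovers (y l ∷ w))
      next [] = count-absents matched (λ ()) post
      next (x k ∷ w) =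
        cong suc (trans (count-matched-tagsY post (x k ∷ w))
        (sym (length-map (y l ∷_) (transCovers (x k ∷ w)))))
      next (y l′ ∷ w) =
        trans (count-matched-tagsY post (y l′ ∷ w)) (sym (length-map (y l ∷_) (transCovers (y l′ ∷ w))))

  count-unmatched-tagsY : ∀ js w → count unmatched (tagsY js w) ≡ length (yDeletions w)
  count-unmatched-tagsY js [] = count-absents unmatched (λ ()) js
  count-unmatched-tagsY js (x k ∷ w) =
    trans (count-unmatched-tagsY js w) (sym (length-map (x k ∷_) (yDeletions w)))
  count-unmatched-tagsY js (y l ∷ w) =
    trans (count-absents-++ unmatched (λ ()) (proj₁ (cut _≟ᶠ_ l js)) _) (next w)
    where
      post = proj₂ (cut _≟ᶠ_ l js)
      next : ∀ w → count unmatched ((l , yTag w) ∷ tagsY post w) ≡ length (yDeletions (y l ∷ w))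
      next [] = cong suc (count-absents unmatched (λ ()) post)
      next (x k ∷ w) =
        trans (count-unmatched-tagsY post (x k ∷ w)) (sym (length-map (y l ∷_) (yDeletions (x k ∷ w))))
      next (y l′ ∷ w) =
        cong suc (trans (count-unmatched-tagsY post (y l′ ∷ w))
        (sym (length-map (y l ∷_) (yDeletions (y l′ ∷ w)))))

  absent-cut : ∀ k w is → Unique is → k ∷ xIndices w ⊆ is →
    filter (absent? (x k ∷ w)) is ≡ proj₁ (cut _≟ᶠ_ k is) ++ filter (absent? w) (proj₂ (cut _≟ᶠ_ k is))
  absent-cut k w is uniq sub = begin
    filter (absent? (x k ∷ w)) is                                        ≡⟨ cong (filter (absent? (x k ∷ w))) is≡ ⟩
    filter (absent? (x k ∷ w)) (pre ++ k ∷ post)                         ≡⟨ filter-++ (absent? (x k ∷ w)) pre _ ⟩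
    filter (absent? (x k ∷ w)) pre ++ filter (absent? (x k ∷ w)) (k ∷ post) ≡⟨ cong₂ _++_ absent-pre absent-post ⟩
    pre ++ filter (absent? w) post                                       ∎
    where
      open ≡-Reasoning
      pre = proj₁ (cut _≟ᶠ_ k is)
      post = proj₂ (cut _≟ᶠ_ k is)
      is≡ = proj₁ (cut-⊆ _≟ᶠ_ is sub)
      uniq′ : Unique (pre ++ k ∷ post)
      uniq′ = subst Unique is≡ uniq
      absent-pre : filter (absent? (x k ∷ w)) pre ≡ pre
      absent-pre = filter-all (absent? (x k ∷ w)) (All.tabulate λ
        { i∈pre (here refl) → All.lookup (proj₂ (proj₂ (cut-⊆ _≟ᶠ_ is sub))) i∈pre refl
        ; i∈pre (there q) → Unique-++-disjoint pre uniq′ i∈pre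
            (there (Sublist.lookup (cut-⊆-rest _≟ᶠ_ is sub) (∈-xIndices⁺ w q))) })
      absent-post : filter (absent? (x k ∷ w)) (k ∷ post) ≡ filter (absent? w) post
      absent-post = trans (filter-reject (absent? (x k ∷ w)) (λ ∉ → ∉ (here refl)))
        (filter-cong-∈ (absent? (x k ∷ w)) (absent? w) post λ i∈post →
          (λ ∉kw q → ∉kw (there q)) ,
          λ { ∉w (here refl) → proj₂ (cut-Unique _≟ᶠ_ is uniq sub) i∈post ; ∉w (there q) → ∉w q })

  count-absent-tagsX : ∀ w is afterY → Unique is → xIndices w ⊆ is →
    count absent (tagsX is afterY w) ≡ length (filter (absent? w) is)
  count-absent-tagsX [] is _ _ _ =
    trans (count-absent-absents is)
      (cong length (sym (filter-all (absent? []) {xs = is} (All.tabulate (λ _ ())))))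
  count-absent-tagsX (y l ∷ w) is _ uniq sub = trans (count-absent-tagsX w is true uniq sub)
    (cong length
      (filter-≐ (absent? w) (absent? (y l ∷ w))
      ((λ ∉w → λ { (there q) → ∉w q }) , (λ ∉yw q → ∉yw (there q))) is))
  count-absent-tagsX (x k ∷ w) is afterY uniq sub = begin
    count absent (absents pre ++ (k , xTag afterY) ∷ tagsX post false w)
      ≡⟨ count-absent-absents-++ pre _ ⟩
    length pre + count absent ((k , xTag afterY) ∷ tagsX post false w)
      ≡⟨ cong (length pre +_) (present afterY) ⟩
    length pre + count absent (tagsX post false w)
      ≡⟨ cong (length pre +_) (count-absent-tagsX w post false (proj₁ (cut-Unique _≟ᶠ_ is uniq sub)) (cut-⊆-rest _≟ᶠ_ is sub)) ⟩
    length pre + length (filter (absent? w) post)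
      ≡⟨ sym (length-++ pre) ⟩
    length (pre ++ filter (absent? w) post)
      ≡⟨ cong length (sym (absent-cut k w is uniq sub)) ⟩
    length (filter (absent? (x k ∷ w)) is) ∎
    where
      open ≡-Reasoning
      pre = proj₁ (cut _≟ᶠ_ k is)
      post = proj₂ (cut _≟ᶠ_ k is)
      present : ∀ b {l} → count absent ((k , xTag b) ∷ l) ≡ count absent l
      present true = refl
      present false = refl

-- Counting valid taggings

isMatched : Tag → Bool
isMatched matched = true
isMatched _ = false

module _ {A : Set} where

  matchMask : List (A × Tag) → List Bool
  matchMask = map (λ (_ , t) → isMatched t)

  #true-matchMask : ∀ l → #true (matchMask l) ≡ count matched l
  #true-matchMask [] = refl
  #true-matchMask ((_ , matched) ∷ l) = cong suc (#true-matchMask l)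
  #true-matchMask ((_ , unmatched) ∷ l) = #true-matchMask l
  #true-matchMask ((_ , absent) ∷ l) = #true-matchMask l

  length-matchMask : ∀ l → length (matchMask l) ≡ length (map proj₁ l)
  length-matchMask l = trans (length-map _ l) (sym (length-map proj₁ l))

-- Selects the non-matched tag counted by in_indel: absent for the x's, unmatched for the y's.
record Marking : Set where
  field
    marked? : Tag → Bool
    tagOf : Bool → Tag
    tagOf-unmatched : tagOf (marked? unmatched) ≡ unmatched
    tagOf-absent : tagOf (marked? absent) ≡ absent
    tagOf-≢ : ∀ b → tagOf b ≢ matched
    marked?-tagOf : ∀ b → marked? (tagOf b) ≡ b

module _ {A : Set} (M : Marking) where
  open Marking M

  marks : List (A × Tag) → List Bool
  marks [] = []
  marks ((_ , matched) ∷ l) = marks l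
  marks ((_ , unmatched) ∷ l) = marked? unmatched ∷ marks l
  marks ((_ , absent) ∷ l) = marked? absent ∷ marks l

  rebuild : List A → List Bool → List Bool → List (A × Tag) × List Bool
  rebuild [] _ r = [] , r
  rebuild (_ ∷ _) [] r = [] , r
  rebuild (i ∷ is) (true ∷ mask) r = let (l , r′) = rebuild is mask r in (i , matched) ∷ l , r′
  rebuild (i ∷ is) (false ∷ mask) [] = [] , []  -- junk: too few bits
  rebuild (i ∷ is) (false ∷ mask) (b ∷ r) = let (l , r′) = rebuild is mask r in (i , tagOf b) ∷ l , r′

  rebuild-split : ∀ (l : List (A × Tag)) r → rebuild (map proj₁ l) (matchMask l) (marks l ++ r) ≡ (l , r)
  rebuild-split [] r = refl
  rebuild-split ((i , matched) ∷ l) r = cong (λ (l′ , r′) → (i , matched) ∷ l′ , r′) (rebuild-split l r)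
  rebuild-split ((i , unmatched) ∷ l) r =
    cong₂ (λ t (l′ , r′) → (i , t) ∷ l′ , r′) tagOf-unmatched (rebuild-split l r)
  rebuild-split ((i , absent) ∷ l) r =
    cong₂ (λ t (l′ , r′) → (i , t) ∷ l′ , r′) tagOf-absent (rebuild-split l r)

  marks-tagOf : ∀ (i : A) b l → marks ((i , tagOf b) ∷ l) ≡ b ∷ marks l
  marks-tagOf i b l with tagOf b | tagOf-≢ b | marked?-tagOf b
  ... | matched | ≢matched | _ = ⊥-elim (≢matched refl)
  ... | unmatched | _ | eq = cong (_∷ marks l) eq
  ... | absent | _ | eq = cong (_∷ marks l) eq

  isMatched-tagOf : ∀ b → isMatched (tagOf b) ≡ false
  isMatched-tagOf b with tagOf b | tagOf-≢ b
  ... | matched | ≢matched = ⊥-elim (≢matched refl)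
  ... | unmatched | _ = refl
  ... | absent | _ = refl

  rebuild-correct : ∀ is mask r → length is ≡ length mask → #false mask ≤ length r →
    let (l , r′) = rebuild is mask r in map proj₁ l ≡ is × matchMask l ≡ mask × marks l ++ r′ ≡ r
  rebuild-correct [] [] r _ _ = refl , refl , refl
  rebuild-correct (i ∷ is) (true ∷ mask) r len le =
    let (fsts≡ , mask≡ , marks≡) = rebuild-correct is mask r (suc-injective len) le
    in cong (i ∷_) fsts≡ , cong (true ∷_) mask≡ , marks≡
  rebuild-correct (i ∷ is) (false ∷ mask) (b ∷ r) len (s≤s le) =
    let (fsts≡ , mask≡ , marks≡) = rebuild-correct is mask r (suc-injective len) le
    in cong (i ∷_) fsts≡ , cong₂ _∷_ (isMatched-tagOf b) mask≡ ,
       trans (cong (_++ _) (marks-tagOf i b _)) (cong (b ∷_) marks≡)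

  #false-matchMask : ∀ l → #false (matchMask l) ≡ length (marks l)
  #false-matchMask [] = refl
  #false-matchMask ((_ , matched) ∷ l) = #false-matchMask l
  #false-matchMask ((_ , unmatched) ∷ l) = cong suc (#false-matchMask l)
  #false-matchMask ((_ , absent) ∷ l) = cong suc (#false-matchMask l)

  rebuild-leftover : ∀ is mask r → length is ≡ length mask → #false mask ≤ length r →
    #false mask + length (proj₂ (rebuild is mask r)) ≡ length r
  rebuild-leftover is mask r len le = begin
    #false mask + length r′              ≡⟨ cong (λ mask → #false mask + length r′) (sym mask≡) ⟩
    #false (matchMask l) + length r′     ≡⟨ cong (_+ length r′) (#false-matchMask l) ⟩
    length (marks l) + length r′         ≡⟨ sym (length-++ (marks l)) ⟩
    length (marks l ++ r′)               ≡⟨ cong length marks≡ ⟩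
    length r                             ∎
    where
      open ≡-Reasoning
      l = proj₁ (rebuild is mask r)
      r′ = proj₂ (rebuild is mask r)
      mask≡ = proj₁ (proj₂ (rebuild-correct is mask r len le))
      marks≡ = proj₂ (proj₂ (rebuild-correct is mask r len le))

markX : Marking
markX = record
  { marked? = λ { absent → true ; _ → false }
  ; tagOf = λ { true → absent ; false → unmatched }
  ; tagOf-unmatched = refl
  ; tagOf-absent = refl
  ; tagOf-≢ = λ { true () ; false () }
  ; marked?-tagOf = λ { true → refl ; false → refl } }

markY : Marking
markY = record
  { marked? = λ { unmatched → true ; _ → false }
  ; tagOf = λ { true → unmatched ; false → absent }
  ; tagOf-unmatched = refl
  ; tagOf-absent = refl
  ; tagOf-≢ = λ { true () ; false () }
  ; marked?-tagOf = λ { true → refl ; false → refl } }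

#true-marks-X : ∀ {A : Set} (l : List (A × Tag)) → #true (marks markX l) ≡ count absent l
#true-marks-X [] = refl
#true-marks-X ((_ , matched) ∷ l) = #true-marks-X l
#true-marks-X ((_ , unmatched) ∷ l) = #true-marks-X l
#true-marks-X ((_ , absent) ∷ l) = cong suc (#true-marks-X l)

#true-marks-Y : ∀ {A : Set} (l : List (A × Tag)) → #true (marks markY l) ≡ count unmatched l
#true-marks-Y [] = refl
#true-marks-Y ((_ , matched) ∷ l) = #true-marks-Y l
#true-marks-Y ((_ , unmatched) ∷ l) = cong suc (#true-marks-Y l)
#true-marks-Y ((_ , absent) ∷ l) = #true-marks-Y l

length-allFin : ∀ k → length (allFin k) ≡ k
length-allFin k = length-tabulate (λ i → i)

module _ (m n a b : ℕ) where

  ValidCode : Tagged m × Tagged n → Set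
  ValidCode (xs , ys) =
    fsts xs ≡ allFin m × fsts ys ≡ allFin n × count matched xs ≡ a × count matched ys ≡ a ×
    count absent xs + count unmatched ys ≡ b

  MaskTriple : Set
  MaskTriple = (List Bool × List Bool) × List Bool

  ValidMasks : MaskTriple → Set
  ValidMasks ((mx , my) , r) =
    (length mx ≡ m × #true mx ≡ a) × (length my ≡ n × #true my ≡ a) ×
      (length r ≡ m + n ∸ (a + a) × #true r ≡ b)

  -- Which x's are matched, which y's are matched, and which of the other m + n - 2a letters are marked.
  toMasks : Tagged m × Tagged n → MaskTriple
  toMasks (xs , ys) = (matchMask xs , matchMask ys) , marks markX xs ++ marks markY ys

  fromMasks : MaskTriple → Tagged m × Tagged n
  fromMasks ((mx , my) , r) =
    let (xs , r′) = rebuild markX (allFin m) mx r in xs , proj₁ (rebuild markY (allFin n) my r′)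

  toMasks-valid : ∀ {c} → ValidCode c → ValidMasks (toMasks c)
  toMasks-valid {xs , ys} (fsts-xs , fsts-ys , matched-xs , matched-ys , marked) =
    (mask-length xs fsts-xs , trans (#true-matchMask xs) matched-xs) ,
    (mask-length ys fsts-ys , trans (#true-matchMask ys) matched-ys) ,
    marks-length ,
      trans (#true-++ (marks markX xs) _) (trans (cong₂ _+_ (#true-marks-X xs) (#true-marks-Y ys)) marked)
    where
      mask-length : ∀ {k} (l : Tagged k) → fsts l ≡ allFin k → length (matchMask l) ≡ k
      mask-length {k} l fsts≡ = trans (length-matchMask l) (trans (cong length fsts≡) (length-allFin k))
      unmarked+matched : ∀ {k} M (l : Tagged k) → fsts l ≡ allFin k → length (marks M l) + count matched l ≡ k
      unmarked+matched M l fsts≡ = trans (sym (cong₂ _+_ (#false-matchMask M l) (#true-matchMask l)))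
        (trans (#false+#true (matchMask l)) (mask-length l fsts≡))
      marks-length : length (marks markX xs ++ marks markY ys) ≡ m + n ∸ (a + a)
      marks-length = trans (length-++ (marks markX xs)) (∸-both _ _ a
        (trans (cong (length (marks markX xs) +_) (sym matched-xs)) (unmarked+matched markX xs fsts-xs))
        (trans (cong (length (marks markY ys) +_) (sym matched-ys)) (unmarked+matched markY ys fsts-ys)))

  private
    module Rebuilt (mx my r : List Bool) (valid : ValidMasks ((mx , my) , r)) where
      length-mx : length mx ≡ m
      length-mx = proj₁ (proj₁ valid)
      #true-mx : #true mx ≡ a
      #true-mx = proj₂ (proj₁ valid)
      length-my : length my ≡ n
      length-my = proj₁ (proj₁ (proj₂ valid))
      #true-my : #true my ≡ a
      #true-my = proj₂ (proj₁ (proj₂ valid))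
      length-r : length r ≡ m + n ∸ (a + a)
      length-r = proj₁ (proj₂ (proj₂ valid))

      unmatched+a : ∀ {k} mask → length mask ≡ k → #true mask ≡ a → #false mask + a ≡ k
      unmatched+a mask len tr = trans (cong (#false mask +_) (sym tr)) (trans (#false+#true mask) len)

      length-r′ : length r ≡ #false mx + #false my
      length-r′ =
        trans length-r
        (sym (∸-both (#false mx) (#false my) a (unmatched+a mx length-mx #true-mx)
        (unmatched+a my length-my #true-my)))

      X = rebuild markX (allFin m) mx r
      xs = proj₁ X
      rest = proj₂ X
      X-length : length (allFin m) ≡ length mx
      X-length = trans (length-allFin m) (sym length-mx)
      X-bits : #false mx ≤ length r
      X-bits = subst (#false mx ≤_) (sym length-r′) (m≤m+n (#false mx) (#false my))
      X-correct = rebuild-correct markX (allFin m) mx r X-length X-bits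
      xs-marks : marks markX xs ++ rest ≡ r
      xs-marks = proj₂ (proj₂ X-correct)

      length-rest : length rest ≡ #false my
      length-rest = +-cancelˡ-≡ (#false mx) _ _ (trans (rebuild-leftover markX (allFin m) mx r X-length X-bits) length-r′)

      Y = rebuild markY (allFin n) my rest
      ys = proj₁ Y
      Y-length : length (allFin n) ≡ length my
      Y-length = trans (length-allFin n) (sym length-my)
      Y-bits : #false my ≤ length rest
      Y-bits = ≤-reflexive (sym length-rest)
      Y-correct = rebuild-correct markY (allFin n) my rest Y-length Y-bits

      leftover-empty : proj₂ Y ≡ []
      leftover-empty = empty (+-cancelˡ-≡ (#false my) _ _
        (trans (rebuild-leftover markY (allFin n) my rest Y-length Y-bits) (trans length-rest (sym (+-identityʳ _)))))
        where
          empty : ∀ {l : List Bool} → length l ≡ 0 → l ≡ []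
          empty {[]} _ = refl

      all-marks : marks markX xs ++ marks markY ys ≡ r
      all-marks = trans (cong (marks markX xs ++_) (trans (sym (++-identityʳ _))
                   (trans (cong (marks markY ys ++_) (sym leftover-empty))
                     (proj₂ (proj₂ Y-correct))))) xs-marks

      matched-count : ∀ {k} (l : Tagged k) mask → matchMask l ≡ mask → #true mask ≡ a → count matched l ≡ a
      matched-count l mask mask≡ tr = trans (sym (#true-matchMask l)) (trans (cong #true mask≡) tr)

  fromMasks-valid : ∀ {t} → ValidMasks t → ValidCode (fromMasks t)
  fromMasks-valid {(mx , my) , r} valid =
    proj₁ X-correct , proj₁ Y-correct ,
    matched-count xs mx (proj₁ (proj₂ X-correct)) #true-mx ,
    matched-count ys my (proj₁ (proj₂ Y-correct)) #true-my ,
    trans (sym (cong₂ _+_ (#true-marks-X xs) (#true-marks-Y ys)))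
      (trans (sym (#true-++ (marks markX xs) _)) (trans (cong #true all-marks) (proj₂ (proj₂ (proj₂ valid)))))
    where open Rebuilt mx my r valid

  toMasks-fromMasks : ∀ {t} → ValidMasks t → toMasks (fromMasks t) ≡ t
  toMasks-fromMasks {(mx , my) , r} valid =
    cong₂ _,_ (cong₂ _,_ (proj₁ (proj₂ X-correct)) (proj₁ (proj₂ Y-correct))) all-marks
    where open Rebuilt mx my r valid

  fromMasks-toMasks : ∀ {c} → ValidCode c → fromMasks (toMasks c) ≡ c
  fromMasks-toMasks {xs , ys} (fsts-xs , fsts-ys , _) =
    cong₂ _,_ (cong proj₁ X)
      (trans (cong (λ r′ → proj₁ (rebuild markY (allFin n) (matchMask ys) r′))
      (cong proj₂ X)) (cong proj₁ Y))
    where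
      X : rebuild markX (allFin m) (matchMask xs) (marks markX xs ++ marks markY ys) ≡
        (xs , marks markY ys)
      X = subst (λ is →
        rebuild markX is (matchMask xs) (marks markX xs ++ marks markY ys) ≡ (xs , marks markY ys))
            fsts-xs (rebuild-split markX xs (marks markY ys))
      Y : rebuild markY (allFin n) (matchMask ys) (marks markY ys) ≡ (ys , [])
      Y = subst (λ is → rebuild markY is (matchMask ys) (marks markY ys) ≡ (ys , [])) fsts-ys
            (subst (λ r → rebuild markY (fsts ys) (matchMask ys) r ≡ (ys , []))
              (++-identityʳ (marks markY ys))
              (rebuild-split markY ys []))

  ValidCode? : ∀ c → Dec (ValidCode c)
  ValidCode? (xs , ys) =
    ≡-dec _≟ᶠ_ (fsts xs) (allFin m) ×-dec ≡-dec _≟ᶠ_ (fsts ys) (allFin n) ×-dec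
    count matched xs ≟ a ×-dec count matched ys ≟ a ×-dec count absent xs + count unmatched ys ≟ b

  ValidMasks? : ∀ t → Dec (ValidMasks t)
  ValidMasks? ((mx , my) , r) =
    (length mx ≟ m ×-dec #true mx ≟ a) ×-dec (length my ≟ n ×-dec #true my ≟ a) ×-dec
    (length r ≟ m + n ∸ (a + a) ×-dec #true r ≟ b)

  Codes↔Fin : Subtype (Tagged m × Tagged n) ValidCode ↔ Fin ((m C a) * (n C a) * ((m + n ∸ (a + a)) C b))
  Codes↔Fin =
    ↔-trans (Subtype-↔ ValidCode? ValidMasks? toMasks fromMasks toMasks-valid fromMasks-valid
    fromMasks-toMasks toMasks-fromMasks)
    (↔-trans (mk↔ₛ′ unpack pack (λ _ → refl) (λ _ → refl))
    (↔-trans ((Choices↔Fin[C] m a ×-↔ Choices↔Fin[C] n a) ×-↔ Choices↔Fin[C] (m + n ∸ (a + a)) b)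
    (↔-trans (↔-sym *↔× ×-↔ ↔-refl) (↔-sym *↔×))))
    where
      unpack : Subtype MaskTriple ValidMasks → (Choices m a × Choices n a) × Choices (m + n ∸ (a + a)) b
      unpack (((mx , my) , r) , [ v ]) =
        ((mx , [ proj₁ v ]) , (my , [ proj₁ (proj₂ v) ])) , (r , [ proj₂ (proj₂ v) ])
      pack : (Choices m a × Choices n a) × Choices (m + n ∸ (a + a)) b → Subtype MaskTriple ValidMasks
      pack (((mx , [ p ]) , (my , [ q ])) , (r , [ s ])) = ((mx , my) , r) , [ p , q , s ]

module _ (m n a b : ℕ) where

  ShuffleStats : Word m n → Set
  ShuffleStats u = Shuffled u × length (transCovers u) ≡ a × length (indelCovers u) ≡ b

  ShuffleStats? : ∀ u → Dec (ShuffleStats u)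
  ShuffleStats? u = allPairs? Before? u ×-dec length (transCovers u) ≟ a ×-dec length (indelCovers u) ≟ b

  covers⇒stats : ∀ {u} → IsShuf u × InTrans≡ u a × InIndel≡ u b → ShuffleStats u
  covers⇒stats {u} ((_ , su) , trans-a , indel-b) =
    su , ↔⇒≡ (↔-trans (↔-sym (TransLowerCovers↔Fin u su)) trans-a) ,
      ↔⇒≡ (↔-trans (↔-sym (IndelLowerCovers↔Fin u su)) indel-b)

  stats⇒covers : ∀ {u} → ShuffleStats u → IsShuf u × InTrans≡ u a × InIndel≡ u b
  stats⇒covers {u} (su , refl , refl) =
    Shuffled⇒IsShuf su , TransLowerCovers↔Fin u su , IndelLowerCovers↔Fin u su

  count-indel-tags : ∀ u → Shuffled u →
    count absent (tagsX (allFin m) false u) + count unmatched (tagsY (allFin n) u) ≡ length (indelCovers u)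
  count-indel-tags u su = begin
    count absent (tagsX (allFin m) false u) + count unmatched (tagsY (allFin n) u)
      ≡⟨ cong₂ _+_ (count-absent-tagsX u (allFin m) false (Uniqueₚ.allFin⁺ m) (xIndices-⊆-allFin u su))
                   (count-unmatched-tagsY (allFin n) u) ⟩
    length (absentX u) + length (yDeletions u)
      ≡⟨ +-comm _ (length (yDeletions u)) ⟩
    length (yDeletions u) + length (absentX u)
      ≡⟨ cong (length (yDeletions u) +_) (sym (length-map _ (absentX u))) ⟩
    length (yDeletions u) + length (xInsertions u)
      ≡⟨ sym (length-++ (yDeletions u)) ⟩
    length (indelCovers u) ∎
    where open ≡-Reasoning

  encode-valid : ∀ {u} → ShuffleStats u → ValidCode m n a b (encode u)
  encode-valid {u} (su , swaps-a , indels-b) =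
    fsts-tagsX u (allFin m) false (xIndices-⊆-allFin u su) ,
      fsts-tagsY u (allFin n) (yIndices-⊆-allFin u su) ,
    trans (count-matched-tagsX (allFin m) u) swaps-a , trans (count-matched-tagsY (allFin n) u) swaps-a ,
    trans (count-indel-tags u su) indels-b

  encode-decode : ∀ {c} → ValidCode m n a b c → encode (uncurry decode c) ≡ c
  encode-decode {xs , ys} (fsts-xs , fsts-ys , matched-xs , matched-ys , _) =
    subst₂ (λ is js → tags is js (decode xs ys) ≡ (xs , ys)) fsts-xs fsts-ys
      (tags-decode xs ys (subst Sorted (sym fsts-xs) (allFin-sorted m))
        (subst Sorted (sym fsts-ys) (allFin-sorted n))
        (trans matched-xs (sym matched-ys)))

  decode-valid : ∀ {c} → ValidCode m n a b c → ShuffleStats (uncurry decode c)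
  decode-valid {xs , ys} valid@(fsts-xs , fsts-ys , matched-xs , _ , indel-b) = su ,
    trans (sym (count-matched-tagsX (allFin m) w))
      (trans (cong (λ c → count matched (proj₁ c)) (encode-decode valid)) matched-xs) ,
    trans (sym (count-indel-tags w su))
      (trans (cong (λ c → count absent (proj₁ c) + count unmatched (proj₂ c)) (encode-decode valid)) indel-b)
    where
      w = decode xs ys
      su : Shuffled w
      su = decode-shuffled xs ys (subst Sorted (sym fsts-xs) (allFin-sorted m))
        (subst Sorted (sym fsts-ys) (allFin-sorted n))

  decode-tags′ : ∀ {u} → ShuffleStats u → uncurry decode (encode u) ≡ u
  decode-tags′ {u} (su , _) =
    decode-tags u (allFin m) (allFin n) (xIndices-⊆-allFin u su) (yIndices-⊆-allFin u su)

lemma3p5 : ∀ (m n a b : ℕ) →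
    HasCard (Σ (Word m n) λ u → Irrelevant (IsShuf u × InTrans≡ u a × InIndel≡ u b))
    ((m C a) * (n C a) * ((m + n ∸ (a + a)) C b))
lemma3p5 m n a b =
  ↔-trans (Subtype-cong (covers⇒stats m n a b) (stats⇒covers m n a b))
  (↔-trans (Subtype-↔ (ShuffleStats? m n a b) (ValidCode? m n a b) encode (uncurry decode)
              (encode-valid m n a b) (decode-valid m n a b) (decode-tags′ m n a b) (encode-decode m n a b))
  (Codes↔Fin m n a b))
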